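{- There is a positive constant $c$ such that, for every positive integer $n$, there is a $4$-regular graph $G$ of order at least $n$ that can be embedded on the torus, and there are two dominating sets $D$ and $D'$ of $G$, both of order $n(G)/5$, such that $$\partial\gamma_G(D,D')\geq c\sqrt{n(G)}.$$
   Context: All graphs are finite, simple and undirected; $n(G)$ denotes the number of vertices of $G$. A set $D\subseteq V(G)$ is a dominating set in $G$ if every vertex of $G$ belongs to $D$ or has a neighbor in $D$. Two dominating sets $D,D'$ are adjacent if $|D\setminus D'|+|D'\setminus D|=1$. For a positive integer $k$, $D$ $k$-transforms to $D'$ if there is a sequence $D_0,\ldots,D_\ell$ of dominating sets in $G$ with $D_0=D$, $D_\ell=D'$, $|D_i|\leq k$ for all $i\in\{0,\ldots,\ell\}$, and $D_{i-1}$ adjacent to $D_i$ for all $i\in\{1,\ldots,\ell\}$. For dominating sets $D,D'$ of $G$, $\partial\gamma_G(D,D')=k-\max\{|D|,|D'|\}$, where $k$ is the smallest positive integer such that $D$ $k$-transforms to $D'$. -}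

module Defs where

open import Data.Nat using (ℕ; zero; suc; _+_; _*_; _≤_; _⊔_; _≡ᵇ_)
open import Data.Bool using (Bool; true; false; if_then_else_)
open import Data.Fin using (Fin)
open import Data.Fin.Subset using (Subset; _∈_; _─_; ∣_∣)
open import Data.List using (List; map; allFin)
open import Data.Nat.ListAction using (sum)
open import Data.Product using (Σ; ∃; ∃-syntax; _×_; _,_)
open import Data.Sum using (_⊎_)
open import Relation.Binary.PropositionalEquality using (_≡_)

record Graph (N : ℕ) : Set where
  field
    adj    : Fin N → Fin N → Bool
    sym    : ∀ u v → adj u v ≡ adj v u
    irrefl : ∀ v → adj v v ≡ false
open Graph public

_~[_]_ : ∀ {N} → Fin N → Graph N → Fin N → Set
u ~[ G ] v = adj G u v ≡ true

deg : ∀ {N} → Graph N → Fin N → ℕ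
deg {N} G v = sum (map (λ u → if adj G v u then 1 else 0) (allFin N))

degSum : ∀ {N} → Graph N → ℕ
degSum {N} G = sum (map (deg G) (allFin N))

isolated : ∀ {N} → Graph N → ℕ
isolated {N} G = sum (map (λ v → if deg G v ≡ᵇ 0 then 1 else 0) (allFin N))

Regular : ∀ {N} → ℕ → Graph N → Set
Regular {N} r G = ∀ (v : Fin N) → deg G v ≡ r

-- Embeddability on the torus, via rotation systems
-- (Heffter–Edmonds–Ringel rotation principle + Euler's formula).

iter : ∀ {A : Set} → (A → A) → ℕ → A → A
iter f zero    x = x
iter f (suc k) x = f (iter f k x)

record RotationSystem {N : ℕ} (G : Graph N) : Set where
  field
    σ      : Fin N → Fin N → Fin N
    closed : ∀ v u → v ~[ G ] u → v ~[ G ] σ v u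
    inj    : ∀ v u w → v ~[ G ] u → v ~[ G ] w → σ v u ≡ σ v w → u ≡ w
    cyc    : ∀ v u w → v ~[ G ] u → v ~[ G ] w → ∃[ k ] iter (σ v) k u ≡ w
open RotationSystem public

-- face-tracing permutation on darts (u , v):  (u , v) ↦ (v , σ v u)
faceStep : ∀ {N} {G : Graph N} → RotationSystem G → Fin N × Fin N → Fin N × Fin N
faceStep ρ (u , v) = (v , σ ρ v u)

data SameFace {N} {G : Graph N} (ρ : RotationSystem G) :
       Fin N × Fin N → Fin N × Fin N → Set where
  here : ∀ {d} → SameFace ρ d d
  next : ∀ {d d'} → SameFace ρ (faceStep ρ d) d' → SameFace ρ d d'

FaceCount : ∀ {N} {G : Graph N} → RotationSystem G → ℕ → Set
FaceCount {N} {G} ρ f =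
  Σ (Fin N → Fin N → Fin f) λ fa →
    (∀ u v u' v' → u ~[ G ] v → u' ~[ G ] v' →
       (fa u v ≡ fa u' v' → SameFace ρ (u , v) (u' , v'))
     × (SameFace ρ (u , v) (u' , v') → fa u v ≡ fa u' v'))
    × (∀ (i : Fin f) → ∃[ u ] ∃[ v ] (u ~[ G ] v × fa u v ≡ i))

data Reach {N} (G : Graph N) : Fin N → Fin N → Set where
  here : ∀ {v} → Reach G v v
  step : ∀ {u v w} → u ~[ G ] v → Reach G v w → Reach G u w

ComponentCount : ∀ {N} → Graph N → ℕ → Set
ComponentCount {N} G c =
  Σ (Fin N → Fin c) λ comp →
    (∀ u v → (comp u ≡ comp v → Reach G u v) × (Reach G u v → comp u ≡ comp v))
    × (∀ (i : Fin c) → ∃[ v ] comp v ≡ i)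

-- G embeds on the torus iff some rotation system has total genus ≤ 1,
-- i.e.  N - |E| + F ≥ 2c - 2, where F = (#faces of ρ) + (#isolated vertices)
-- (an isolated vertex forms a sphere component with one face).
-- Multiplied by 2 (2|E| = degSum) to stay in ℕ.
EmbedsOnTorus : ∀ {N} → Graph N → Set
EmbedsOnTorus {N} G =
  Σ (RotationSystem G) λ ρ → ∃[ f ] ∃[ c ]
    (FaceCount ρ f × ComponentCount G c
     × degSum G + 4 * c ≤ 2 * N + 2 * (f + isolated G) + 4)

Dominating : ∀ {N} → Graph N → Subset N → Set
Dominating {N} G D = ∀ (v : Fin N) → v ∈ D ⊎ ∃[ u ] (v ~[ G ] u × u ∈ D)

AdjacentSets : ∀ {N} → Subset N → Subset N → Set
AdjacentSets D D' = ∣ D ─ D' ∣ + ∣ D' ─ D ∣ ≡ 1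

data KTransforms {N} (G : Graph N) (k : ℕ) : Subset N → Subset N → Set where
  done : ∀ {D} → Dominating G D → ∣ D ∣ ≤ k → KTransforms G k D D
  step : ∀ {D E D'} → Dominating G D → ∣ D ∣ ≤ k → AdjacentSets D E →
         KTransforms G k E D' → KTransforms G k D D'

ReconfDist : ∀ {N} → Graph N → Subset N → Subset N → ℕ → Set
ReconfDist G D D' d =
  let k = d + (∣ D ∣ ⊔ ∣ D' ∣) in
  1 ≤ k × KTransforms G k D D'
  × (∀ k' → 1 ≤ k' → KTransforms G k' D D' → k ≤ k')

{-# OPTIONS --safe #-}
-- G is the torus grid C_p □ C_p with p = 50 m, so n(G) = 2500 m², and D, D′ are two of the ten
-- perfect codes of the 5 × 5 torus, lifted along C_p → C_5: every closed neighbourhood meets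
-- them exactly once, hence |D| = |D′| = n(G)/5.
--
-- Double counting closed neighbourhoods shows that a dominating set with fewer than n(G)/5 + m
-- elements dominates fewer than 5m vertices twice. If the 13 cells within distance 2 of a vertex
-- are dominated exactly once, the set coincides on the 25 cells within distance 3 with one of the
-- ten codes (an exhaustive search), and adjacent such vertices see the same code; so every row and
-- every column that stays away from the doubly dominated vertices follows a single code. A
-- reconfiguration step changes one vertex; some row is far from it and from the doubly dominated
-- vertices of both sets, and some column is perfect for the new set and crosses every row. Hence
-- the invariant that every row following a single code follows the code of D survives each step of
-- a sequence of sets of size < n(G)/5 + m, while it fails for D′. So ∂γ(D, D′) ≥ m = √n(G) / 50.

module Submission where

open import Defs hiding (sym)
open import Data.Nat using (ℕ; suc; _*_; _≤_)
open import Data.Fin.Subset using (Subset; ∣_∣)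
open import Data.Product using (Σ; ∃-syntax; _×_)
open import Relation.Binary.PropositionalEquality using (_≡_)

open import Data.Bool as Bool using (Bool; true; false; T; _∧_; _∨_; _xor_; if_then_else_)
open import Data.Bool.ListAction using (all; any)
open import Data.Bool.Properties using (T-∨; T-∧)
open import Data.Empty using (⊥-elim)
open import Data.Fin as Fin using (Fin; zero; suc; toℕ; fromℕ<)
open import Data.Fin.Permutation using (permutation)
open import Data.Fin.Properties as Fin
  using (¬∀⟶∃¬; injective⇒≤; toℕ-fromℕ<; toℕ-injective; toℕ<n; fromℕ<-toℕ)
open import Data.Fin.Subset using (_─_; _∩_; _⊆_; ⊤) renaming (_∈_ to _∈ₛ_)
open import Data.Fin.Subset.Properties using (∣p∣≤n; x∈p∩q⁻; ∩-identityʳ; ∩-identityˡ) renaming (_∈?_ to _∈ₛ?_)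
open import Data.Integer as ℤ using (ℤ; -[1+_])
open import Data.List as List
  using (List; []; _∷_; _++_; upTo; cartesianProduct; length; map; filter; tabulate; allFin)
open import Data.List.Properties
  using (map-tabulate; map-∘; map-cong; length-++; length-map; length-upTo; filter-notAll)
open import Data.List.Membership.Propositional using (_∈_; _∉_)
open import Data.List.Membership.Propositional.Properties
  using (∈-map⁺; ∈-map⁻; ∈-filter⁺; ∈-filter⁻; ∈-++⁺ˡ; ∈-++⁺ʳ; ∈-allFin)
open import Data.List.Relation.Binary.Subset.Propositional using () renaming (_⊆_ to _⊆ₗ_)
open import Data.List.Relation.Unary.All as All using (All; []; _∷_)
open import Data.List.Relation.Unary.All.Properties using (All¬⇒¬Any; all⁺; filter⁺)
open import Data.List.Relation.Unary.Any as Any using (here; there; satisfied)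
open import Data.List.Relation.Unary.Any.Properties using (any⁻; lookup-index)
open import Data.List.Relation.Unary.Unique.Propositional using (Unique; []; _∷_)
import Data.List.Relation.Unary.Unique.Propositional.Properties as Unique
open import Data.Maybe using (Maybe; just; nothing)
open import Data.Maybe.Properties using (just-injective)
open import Data.Nat using (zero; pred; _+_; _∸_; _⊔_; _<_; _≤?_; _≟_; _≡ᵇ_; _≤ᵇ_; s≤s; z≤n)
open import Data.Nat.Divisibility using (_∣_; divides)
open import Data.Nat.DivMod using (_mod_; _%_; m∣n⇒o%n%m≡o%m; %-distribˡ-+; m%n%n≡m%n; [m+n]%n≡m%n; m<n⇒m%n≡m)
open import Data.Nat.Induction using (<-rec)
open import Data.Nat.ListAction using () renaming (sum to listSum)
open import Data.Nat.Properties
open import Data.Nat.Tactic.RingSolver using (solve-∀)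
open import Data.Product using (_,_; proj₁; proj₂; ∃)
open import Data.Product.Properties using (≡-dec)
open import Data.Sum using (inj₁; inj₂)
open import Data.Unit using (tt)
open import Data.Vec as Vec using ([]; _∷_; lookup; here; there)
open import Data.Vec.Properties using ([]=⇒lookup; lookup⇒[]=; lookup∘tabulate) renaming (≡-dec to ≡-decᵥ)
open import Function using (id; _∘_; mk⇔; Equivalence)
open import Relation.Binary.Definitions using (DecidableEquality)
open import Relation.Binary.PropositionalEquality
  using (_≢_; refl; sym; trans; cong; cong₂; subst; subst₂; module ≡-Reasoning)
open import Relation.Nullary using (¬_; Dec; yes; no; does)
open import Relation.Nullary.Decidable
  using (¬?; dec-true; dec-false; does-⇔; map′; toWitness; _×-dec_; _⊎-dec_; _→-dec_)
open import Relation.Nullary.Negation using (contradiction)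
open import Relation.Unary using (Decidable)

open import Algebra.Properties.CommutativeMonoid.Sum +-0-commutativeMonoid
  using (sum; sum-cong-≗; ∑-distrib-+; sum-permute)

𝟙 : Bool → ℕ
𝟙 b = if b then 1 else 0

count : {X : Set} → (X → Bool) → List X → ℕ
count f xs = listSum (map (𝟙 ∘ f) xs)

listSum-allFin : ∀ {n} (f : Fin n → ℕ) → listSum (map f (allFin n)) ≡ sum f
listSum-allFin f = trans (cong listSum (map-tabulate id f)) (listSum-tabulate f)
  where
  listSum-tabulate : ∀ {n} (f : Fin n → ℕ) → listSum (tabulate f) ≡ sum f
  listSum-tabulate {zero}  f = refl
  listSum-tabulate {suc n} f = cong (f zero +_) (listSum-tabulate (f ∘ suc))

sum-const : ∀ n c → sum {n} (λ _ → c) ≡ n * c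
sum-const zero    c = refl
sum-const (suc n) c = cong (c +_) (sum-const n c)

sum-zero : ∀ n → sum {n} (λ _ → 0) ≡ 0
sum-zero n = trans (sum-const n 0) (*-zeroʳ n)

sum-mono-≤ : ∀ {n} {f g : Fin n → ℕ} → (∀ i → f i ≤ g i) → sum f ≤ sum g
sum-mono-≤ {zero}  f≤g = z≤n
sum-mono-≤ {suc n} f≤g = +-mono-≤ (f≤g zero) (sum-mono-≤ (f≤g ∘ suc))

sum-listSum : ∀ {n} {A : Set} (g : Fin n → A → ℕ) xs →
              sum (λ i → listSum (map (g i) xs)) ≡ listSum (map (λ x → sum (λ i → g i x)) xs)
sum-listSum {n} g []       = sum-zero n
sum-listSum {n} g (x ∷ xs) = trans (∑-distrib-+ {n} _ _) (cong (sum (λ i → g i x) +_) (sum-listSum g xs))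

sum-𝟙-≟ : ∀ {n} (j : Fin n) → sum (λ i → 𝟙 (does (i Fin.≟ j))) ≡ 1
sum-𝟙-≟ {suc n} zero    = cong suc (sum-zero n)
sum-𝟙-≟ {suc n} (suc j) = sum-𝟙-≟ j

module _ {n : ℕ} where

  open import Data.List.Membership.DecPropositional (Fin._≟_ {n}) using (_∈?_)

  sum-𝟙-∈ : ∀ {xs : List (Fin n)} → Unique xs → sum (λ i → 𝟙 (does (i ∈? xs))) ≡ length xs
  sum-𝟙-∈ {[]}     []            = sum-zero n
  sum-𝟙-∈ {x ∷ xs} (x≢xs ∷ uniq) = begin
    sum (λ i → 𝟙 (does (i Fin.≟ x) ∨ does (i ∈? xs)))                   ≡⟨ sum-cong-≗ split ⟩
    sum (λ i → 𝟙 (does (i Fin.≟ x)) + 𝟙 (does (i ∈? xs)))               ≡⟨ ∑-distrib-+ {n} _ _ ⟩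
    sum (λ i → 𝟙 (does (i Fin.≟ x))) + sum (λ i → 𝟙 (does (i ∈? xs)))
      ≡⟨ cong₂ _+_ (sum-𝟙-≟ x) (sum-𝟙-∈ uniq) ⟩
    suc (length xs)                                                    ∎
    where
    open ≡-Reasoning
    split : ∀ i → 𝟙 (does (i Fin.≟ x) ∨ does (i ∈? xs)) ≡ 𝟙 (does (i Fin.≟ x)) + 𝟙 (does (i ∈? xs))
    split i with i Fin.≟ x
    ... | yes refl rewrite dec-false (x ∈? xs) (All¬⇒¬Any x≢xs) = refl
    ... | no _     = refl

  -- If every element occurred in xs, its position in xs would inject Fin n into Fin (length xs).
  missing : ∀ (xs : List (Fin n)) → length xs < n → ∃ (_∉ xs)
  missing xs xs<n = ¬∀⟶∃¬ n (_∈ xs) (_∈? xs) λ all∈ →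
    <⇒≱ xs<n (injective⇒≤ {f = λ y → Any.index (all∈ y)} λ {y} {y′} eq →
      trans (lookup-index (all∈ y)) (trans (cong (List.lookup xs) eq) (sym (lookup-index (all∈ y′)))))

∣p∣≡sum : ∀ {n} (p : Subset n) → ∣ p ∣ ≡ sum (𝟙 ∘ lookup p)
∣p∣≡sum []          = refl
∣p∣≡sum (true ∷ p)  = cong suc (∣p∣≡sum p)
∣p∣≡sum (false ∷ p) = ∣p∣≡sum p

length-filter : ∀ {A : Set} {P : A → Set} (P? : Decidable P) xs →
                length (filter P? xs) ≡ count (does ∘ P?) xs
length-filter P? []       = refl
length-filter P? (x ∷ xs) with does (P? x)
... | true  = cong suc (length-filter P? xs)
... | false = length-filter P? xs

sum-excess : ∀ {n} (f : Fin n → ℕ) → (∀ i → 1 ≤ f i) → n + sum (λ i → 𝟙 (does (2 ≤? f i))) ≤ sum f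
sum-excess {n} f pos = begin
  n + sum excess                       ≡⟨ cong (_+ sum excess) (trans (sym (*-identityʳ n)) (sym (sum-const n 1))) ⟩
  sum {n} (λ _ → 1) + sum excess       ≡⟨ ∑-distrib-+ {n} _ _ ⟨
  sum (λ i → 1 + excess i)             ≤⟨ sum-mono-≤ (λ i → 1+excess≤ (pos i)) ⟩
  sum f                                ∎
  where
  open ≤-Reasoning
  excess : Fin n → ℕ
  excess i = 𝟙 (does (2 ≤? f i))
  1+excess≤ : ∀ {a} → 1 ≤ a → 1 + 𝟙 (does (2 ≤? a)) ≤ a
  1+excess≤ {suc zero}    _ = ≤-refl
  1+excess≤ {suc (suc a)} _ = s≤s (s≤s z≤n)

𝟙-mono : ∀ {a b} → (T a → T b) → 𝟙 a ≤ 𝟙 b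
𝟙-mono {false}         _   = z≤n
𝟙-mono {true}  {true}  _   = ≤-refl
𝟙-mono {true}  {false} a⇒b = ⊥-elim (a⇒b tt)

count-mono : ∀ {X : Set} {f g : X → Bool} → (∀ x → T (f x) → T (g x)) → ∀ xs → count f xs ≤ count g xs
count-mono f⇒g []       = z≤n
count-mono f⇒g (x ∷ xs) = +-mono-≤ (𝟙-mono (f⇒g x)) (count-mono f⇒g xs)

count-none : ∀ {X : Set} {f : X → Bool} {xs} → All (λ x → f x ≡ false) xs → count f xs ≡ 0
count-none []             = refl
count-none (fx≡false ∷ h) rewrite fx≡false = count-none h

count-map : ∀ {X Y : Set} (f : Y → Bool) (g : X → Y) xs → count f (map g xs) ≡ count (f ∘ g) xs
count-map f g xs = cong listSum (sym (map-∘ xs))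

count-cong : ∀ {X : Set} {f g : X → Bool} → (∀ x → f x ≡ g x) → ∀ xs → count f xs ≡ count g xs
count-cong f≗g xs = cong listSum (map-cong (cong 𝟙 ∘ f≗g) xs)

count-pos⁺ : ∀ {X : Set} (f : X → Bool) {x xs} → x ∈ xs → f x ≡ true → 1 ≤ count f xs
count-pos⁺ f {xs = _ ∷ xs} (here refl) fx = subst (λ b → 1 ≤ 𝟙 b + count f xs) (sym fx) (s≤s z≤n)
count-pos⁺ f {xs = y ∷ _}  (there x∈)  fx = ≤-trans (count-pos⁺ f x∈ fx) (m≤n+m _ (𝟙 (f y)))

count-pos⁻ : ∀ {X : Set} (f : X → Bool) xs → 1 ≤ count f xs → ∃[ x ] (x ∈ xs × f x ≡ true)
count-pos⁻ f (x ∷ xs) pos with f x in fx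
... | true  = x , here refl , fx
... | false = let y , y∈ , fy = count-pos⁻ f xs pos in y , there y∈ , fy

Least : (ℕ → Set) → ℕ → Set
Least P k = P k × ∀ {k′} → P k′ → k ≤ k′

least : ∀ {P : ℕ → Set} → Decidable P → ∀ {m} → P m → ∃ (Least P)
least {P} P? {m} = <-rec (λ m → P m → ∃ (Least P)) search m
  where
  search : ∀ m → (∀ {j} → j < m → P j → ∃ (Least P)) → P m → ∃ (Least P)
  search m below Pm with anyUpTo? P? m
  ... | yes (j , j<m , Pj) = below j<m Pj
  ... | no  none           = m , Pm , λ {k′} Pk′ → ≮⇒≥ λ k′<m → none (k′ , k′<m , Pk′)

iter-hom : ∀ {A B : Set} {f : A → A} {g : B → B} (h : A → B) →
           (∀ x → h (f x) ≡ g (h x)) → ∀ k x → h (iter f k x) ≡ iter g k (h x)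
iter-hom         h hf zero    x = refl
iter-hom {g = g} h hf (suc k) x = trans (hf _) (cong g (iter-hom h hf k x))

iter-invariant : ∀ {A B : Set} {f : A → A} (h : A → B) → (∀ x → h (f x) ≡ h x) → ∀ k x → h (iter f k x) ≡ h x
iter-invariant h hf zero    x = refl
iter-invariant h hf (suc k) x = trans (hf _) (iter-invariant h hf k x)

iter-inverse : ∀ {A : Set} {f g : A → A} → (∀ x → g (f x) ≡ x) → ∀ k x → iter g k (iter f k x) ≡ x
iter-inverse             gf zero    x = refl
iter-inverse {f = f} {g} gf (suc k) x = begin
  g (iter g k (f (iter f k x))) ≡⟨ iter-hom {f = g} {g = g} g (λ _ → refl) k _ ⟩
  iter g k (g (f (iter f k x))) ≡⟨ cong (iter g k) (gf _) ⟩
  iter g k (iter f k x)         ≡⟨ iter-inverse gf k x ⟩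
  x                             ∎
  where open ≡-Reasoning

T-∧-proj₂ : ∀ {a b} → T (a ∧ b) → T b
T-∧-proj₂ {true} t = t

does-true : ∀ {A : Set} (a? : Dec A) → does a? ≡ true → A
does-true (yes a) _ = a

module PrunedSearch {A : Set} (_≟_ : DecidableEquality A) where

  Assignment : Set
  Assignment = List (A × Bool)

  valueOf : Assignment → A → Maybe Bool
  valueOf []             a = nothing
  valueOf ((a′ , b) ∷ σ) a = if does (a ≟ a′) then just b else valueOf σ a

  Consistent : (A → Bool) → Assignment → Set
  Consistent f = All (λ (a , b) → f a ≡ b)

  valueOf-sound : ∀ {f σ a b} → Consistent f σ → valueOf σ a ≡ just b → f a ≡ b
  valueOf-sound {σ = (a′ , _) ∷ _} {a} (fa′≡b′ ∷ f∼σ) eq with a ≟ a′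
  ... | yes refl = trans fa′≡b′ (just-injective eq)
  ... | no _     = valueOf-sound f∼σ eq

  known : Bool → Maybe Bool → Bool
  known true  (just true)  = true
  known false (just false) = true
  known _     _            = false

  known-sound : ∀ {f σ a} b → Consistent f σ → T (known b (valueOf σ a)) → f a ≡ b
  known-sound {σ = σ} {a} b f∼σ ok with valueOf σ a in eq | b
  ... | just true  | true  = valueOf-sound f∼σ eq
  ... | just false | false = valueOf-sound f∼σ eq

  search : (refute accept : Assignment → Bool) → List A → Assignment → Bool
  search refute accept []       σ = refute σ ∨ accept σ
  search refute accept (a ∷ as) σ =
    refute σ ∨ (search refute accept as ((a , true) ∷ σ) ∧ search refute accept as ((a , false) ∷ σ))

  module _ {Hyp Goal : (A → Bool) → Set} {refute accept : Assignment → Bool}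
           (refute-sound : ∀ {f σ} → Consistent f σ → T (refute σ) → ¬ Hyp f)
           (accept-sound : ∀ {f σ} → Consistent f σ → T (accept σ) → Hyp f → Goal f) where

    search-sound : ∀ as {f σ} → Consistent f σ → T (search refute accept as σ) → Hyp f → Goal f
    search-sound []       f∼σ ok hyp with Equivalence.to T-∨ ok
    ... | inj₁ r = contradiction hyp (refute-sound f∼σ r)
    ... | inj₂ a = accept-sound f∼σ a hyp
    search-sound (a ∷ as) {f} f∼σ ok hyp with Equivalence.to T-∨ ok
    ... | inj₁ r    = contradiction hyp (refute-sound f∼σ r)
    ... | inj₂ both with Equivalence.to T-∧ both | f a in fa
    ...   | ok-t , _ | true  = search-sound as (fa ∷ f∼σ) ok-t hyp
    ...   | _ , ok-f | false = search-sound as (fa ∷ f∼σ) ok-f hyp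

-- Reconfiguration sequences in an arbitrary graph

hamming : ∀ {m} → Subset m → Subset m → ℕ
hamming []      []      = 0
hamming (b ∷ S) (c ∷ E) = 𝟙 (b xor c) + hamming S E

hamming-refl : ∀ {m} (S : Subset m) → hamming S S ≡ 0
hamming-refl []          = refl
hamming-refl (true ∷ S)  = hamming-refl S
hamming-refl (false ∷ S) = hamming-refl S

∣─∣+∣─∣≡hamming : ∀ {m} (S E : Subset m) → ∣ S ─ E ∣ + ∣ E ─ S ∣ ≡ hamming S E
∣─∣+∣─∣≡hamming []          []          = refl
∣─∣+∣─∣≡hamming (true ∷ S)  (true ∷ E)  = ∣─∣+∣─∣≡hamming S E
∣─∣+∣─∣≡hamming (false ∷ S) (false ∷ E) = ∣─∣+∣─∣≡hamming S E
∣─∣+∣─∣≡hamming (true ∷ S)  (false ∷ E) = cong suc (∣─∣+∣─∣≡hamming S E)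
∣─∣+∣─∣≡hamming (false ∷ S) (true ∷ E)  =
  trans (+-suc ∣ S ─ E ∣ ∣ E ─ S ∣) (cong suc (∣─∣+∣─∣≡hamming S E))

hamming-zero : ∀ {m} (S E : Subset m) → hamming S E ≡ 0 → S ≡ E
hamming-zero []          []          _  = refl
hamming-zero (true ∷ S)  (true ∷ E)  eq = cong (true ∷_) (hamming-zero S E eq)
hamming-zero (false ∷ S) (false ∷ E) eq = cong (false ∷_) (hamming-zero S E eq)

hamming-one : ∀ {m} (S E : Subset m) → hamming S E ≡ 1 → ∃[ z ] ∀ w → w ≢ z → lookup S w ≡ lookup E w
hamming-one []          []          ()
hamming-one (true ∷ S)  (false ∷ E) eq = zero , λ
  { zero    w≢z → contradiction refl w≢z
  ; (suc w) _   → cong (λ U → lookup U w) (hamming-zero S E (suc-injective eq)) }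
hamming-one (false ∷ S) (true ∷ E)  eq = zero , λ
  { zero    w≢z → contradiction refl w≢z
  ; (suc w) _   → cong (λ U → lookup U w) (hamming-zero S E (suc-injective eq)) }
hamming-one (true ∷ S)  (true ∷ E)  eq =
  let z , same = hamming-one S E eq in suc z , λ { zero _ → refl ; (suc w) w≢z → same w (w≢z ∘ cong suc) }
hamming-one (false ∷ S) (false ∷ E) eq =
  let z , same = hamming-one S E eq in suc z , λ { zero _ → refl ; (suc w) w≢z → same w (w≢z ∘ cong suc) }

toward : ∀ {m h} (S E : Subset m) → hamming S E ≡ suc h →
         ∃[ S′ ] (hamming S S′ ≡ 1 × hamming S′ E ≡ h × S ∩ E ⊆ S′ ∩ E)
toward []          []          ()
toward (true ∷ S)  (false ∷ E) eq =
  false ∷ S , cong suc (hamming-refl S) , suc-injective eq , λ { (there x∈) → there x∈ }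
toward (false ∷ S) (true ∷ E)  eq =
  true ∷ S , cong suc (hamming-refl S) , suc-injective eq , λ { (there x∈) → there x∈ }
toward (true ∷ S)  (true ∷ E)  eq =
  let S′ , d₁ , dₕ , sub = toward S E eq
  in true ∷ S′ , d₁ , dₕ , λ { here → here ; (there x∈) → there (sub x∈) }
toward (false ∷ S) (false ∷ E) eq =
  let S′ , d₁ , dₕ , sub = toward S E eq
  in false ∷ S′ , d₁ , dₕ , λ { (there x∈) → there (sub x∈) }

allSubsets : ∀ n → List (Subset n)
allSubsets zero    = [] ∷ []
allSubsets (suc n) = map (true ∷_) (allSubsets n) ++ map (false ∷_) (allSubsets n)

allSubsets-complete : ∀ {n} (S : Subset n) → S ∈ allSubsets n
allSubsets-complete []                  = here refl
allSubsets-complete {suc n} (true ∷ S)  = ∈-++⁺ˡ (∈-map⁺ (true ∷_) (allSubsets-complete S))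
allSubsets-complete {suc n} (false ∷ S) =
  ∈-++⁺ʳ (map (true ∷_) (allSubsets n)) (∈-map⁺ (false ∷_) (allSubsets-complete S))

module Reconfiguration {n} (G : Graph n) where

  dominating-⊆ : ∀ {S U} → S ⊆ U → Dominating G S → Dominating G U
  dominating-⊆ S⊆U dom v with dom v
  ... | inj₁ v∈S             = inj₁ (S⊆U v∈S)
  ... | inj₂ (u , v~u , u∈S) = inj₂ (u , v~u , S⊆U u∈S)

  dominating? : Decidable (Dominating G)
  dominating? S = Fin.all? λ v → v ∈ₛ? S ⊎-dec Fin.any? λ u → (adj G v u Bool.≟ true) ×-dec u ∈ₛ? S

  kt-trans : ∀ {k S E F} → KTransforms G k S E → KTransforms G k E F → KTransforms G k S F
  kt-trans (done _ _)      Q = Q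
  kt-trans (step d ≤k a P) Q = step d ≤k a (kt-trans P Q)

  kt-mono : ∀ {k k′ S E} → k ≤ k′ → KTransforms G k S E → KTransforms G k′ S E
  kt-mono k≤k′ (done d ≤k)     = done d (≤-trans ≤k k≤k′)
  kt-mono k≤k′ (step d ≤k a P) = step d (≤-trans ≤k k≤k′) a (kt-mono k≤k′ P)

  kt-first : ∀ {k S E} → KTransforms G k S E → Dominating G S × ∣ S ∣ ≤ k
  kt-first (done d ≤k)     = d , ≤k
  kt-first (step d ≤k _ _) = d , ≤k

  kt-last : ∀ {k S E} → KTransforms G k S E → Dominating G E × ∣ E ∣ ≤ k
  kt-last (done d ≤k)    = d , ≤k
  kt-last (step _ _ _ P) = kt-last P

  -- Flipping the differing elements one at a time keeps every intermediate set above S ∩ E.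
  walk : ∀ h S E → hamming S E ≡ h → Dominating G (S ∩ E) → KTransforms G n S E
  walk zero S E eq dom with hamming-zero S E eq
  ... | refl = done (dominating-⊆ (proj₁ ∘ x∈p∩q⁻ S S) dom) (∣p∣≤n S)
  walk (suc h) S E eq dom with toward S E eq
  ... | S′ , d₁ , dₕ , sub =
    step (dominating-⊆ (proj₁ ∘ x∈p∩q⁻ S E) dom) (∣p∣≤n S) (trans (∣─∣+∣─∣≡hamming S S′) d₁)
         (walk h S′ E dₕ (dominating-⊆ sub dom))

  transform-via-⊤ : ∀ {D D′} → Dominating G D → Dominating G D′ → KTransforms G n D D′
  transform-via-⊤ {D} {D′} dom dom′ =
    kt-trans (walk _ D ⊤ refl (subst (Dominating G) (sym (∩-identityʳ D)) dom))
             (walk _ ⊤ D′ refl (subst (Dominating G) (sym (∩-identityˡ D′)) dom′))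

  module Decidability (k : ℕ) (t : Subset n) where

    _≟ₛ_ : DecidableEquality (Subset n)
    _≟ₛ_ = ≡-decᵥ Bool._≟_

    open import Data.List.Membership.DecPropositional _≟ₛ_ using (_∈?_)

    Valid : Subset n → Set
    Valid S = Dominating G S × ∣ S ∣ ≤ k

    valid? : Decidable Valid
    valid? S = dominating? S ×-dec ∣ S ∣ ≤? k

    Path : Subset n → Set
    Path S = KTransforms G k S t

    later : ∀ {S} → Path S → List (Subset n)
    later (done _ _)             = []
    later (step {E = E} _ _ _ P) = E ∷ later P

    steps : ∀ {S} → Path S → ℕ
    steps (done _ _)     = 0
    steps (step _ _ _ P) = suc (steps P)

    from-visit : ∀ {S u} (P : Path S) → u ∈ later P →
                 Σ (Path u) λ Q → steps Q < steps P × later Q ⊆ₗ later P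
    from-visit (step _ _ _ P) (here refl) = P , ≤-refl , there
    from-visit (step _ _ _ P) (there u∈)  =
      let Q , Q<P , Q⊆P = from-visit P u∈ in Q , ≤-trans Q<P (n≤1+n _) , there ∘ Q⊆P

    last-visit : ∀ m {u} (P : Path u) → steps P ≤ m →
                 Σ (Path u) λ Q → steps Q ≤ steps P × later Q ⊆ₗ later P × u ∉ later Q
    last-visit m {u} P P≤m with u ∈? later P
    ... | no  u∉ = P , ≤-refl , id , u∉
    last-visit zero    P P≤m | yes u∈ = contradiction (≤-trans (proj₁ (proj₂ (from-visit P u∈))) P≤m) λ ()
    last-visit (suc m) P P≤m | yes u∈ =
      let Q , Q<P , Q⊆P       = from-visit P u∈
          R , R≤Q , R⊆Q , u∉R = last-visit m Q (≤-pred (≤-trans Q<P P≤m))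
      in R , ≤-trans R≤Q (<⇒≤ Q<P) , Q⊆P ∘ R⊆Q , u∉R

    _∖_ : List (Subset n) → Subset n → List (Subset n)
    U ∖ E = filter (λ S → ¬? (S ≟ₛ E)) U

    -- Paths whose later sets are distinct members of U. Restarting a path at the last visit of
    -- its next set (last-visit) turns every path into one, and there are finitely many of them.
    data FreshPath (U : List (Subset n)) : Subset n → Set where
      arrive : Valid t → FreshPath U t
      leave  : ∀ {S E} → Valid S → AdjacentSets S E → E ∈ U → FreshPath (U ∖ E) E → FreshPath U S

    fresh⇒path : ∀ {U S} → FreshPath U S → Path S
    fresh⇒path (arrive (d , ≤k))         = done d ≤k
    fresh⇒path (leave (d , ≤k) a _ rest) = step d ≤k a (fresh⇒path rest)

    path⇒fresh : ∀ m {S} (P : Path S) → steps P ≤ m → ∀ U → later P ⊆ₗ U → FreshPath U S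
    path⇒fresh m       (done d ≤k)               _   U _   = arrive (d , ≤k)
    path⇒fresh (suc m) (step {E = E} d ≤k a P) P≤m U P⊆U =
      let R , R≤P , R⊆P , E∉R = last-visit (steps P) P ≤-refl
          R⊆U∖E : later R ⊆ₗ U ∖ E
          R⊆U∖E {x} x∈R = ∈-filter⁺ (λ S → ¬? (S ≟ₛ E)) (P⊆U (there (R⊆P x∈R)))
                                    λ x≡E → E∉R (subst (_∈ later R) x≡E x∈R)
      in leave (d , ≤k) a (P⊆U (here refl)) (path⇒fresh m R (≤-trans R≤P (≤-pred P≤m)) (U ∖ E) R⊆U∖E)

    any-∈? : ∀ {P : Subset n → Set} U → (∀ E → E ∈ U → Dec (P E)) → Dec (∃[ E ] (E ∈ U × P E))
    any-∈? []      P? = no λ ()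
    any-∈? (E ∷ U) P? with P? E (here refl) | any-∈? U (λ E′ → P? E′ ∘ there)
    ... | yes pE  | _                     = yes (E , here refl , pE)
    ... | no  _   | yes (E′ , E′∈U , pE′) = yes (E′ , there E′∈U , pE′)
    ... | no  ¬pE | no  none              =
      no λ { (_ , here refl , pE) → ¬pE pE ; (E′ , there E′∈U , pE′) → none (E′ , E′∈U , pE′) }

    ∖-shrinks : ∀ {E U m} → E ∈ U → length U ≤ suc m → length (U ∖ E) ≤ m
    ∖-shrinks {E} {U} E∈U U≤ =
      ≤-pred (≤-trans (filter-notAll (λ S → ¬? (S ≟ₛ E)) U (Any.map (λ E≡x x≢E → x≢E (sym E≡x)) E∈U)) U≤)

    fresh? : ∀ m U → length U ≤ m → ∀ S → Dec (FreshPath U S)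
    fresh? m U U≤m S = decide (S ≟ₛ t ×-dec valid? t) (leave? m U≤m)
      where
      Leave : Set
      Leave = ∃[ E ] (E ∈ U × Valid S × AdjacentSets S E × FreshPath (U ∖ E) E)

      nonempty : ∀ {E U} → E ∈ U → ¬ (length U ≤ 0)
      nonempty {U = _ ∷ _} _ ()

      leave? : ∀ m → length U ≤ m → Dec Leave
      leave? zero    U≤0 = no λ { (_ , E∈U , _) → nonempty E∈U U≤0 }
      leave? (suc m) U≤m = any-∈? U λ E E∈U →
        valid? S ×-dec ((∣ S ─ E ∣ + ∣ E ─ S ∣) ≟ 1) ×-dec fresh? m (U ∖ E) (∖-shrinks E∈U U≤m) E

      decide : Dec (S ≡ t × Valid t) → Dec Leave → Dec (FreshPath U S)
      decide (yes (refl , v)) _                              = yes (arrive v)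
      decide (no _)           (yes (_ , E∈U , v , a , rest)) = yes (leave v a E∈U rest)
      decide (no ¬arrive)     (no ¬leave)                    = no λ
        { (arrive v)           → ¬arrive (refl , v)
        ; (leave v a E∈U rest) → ¬leave (_ , E∈U , v , a , rest) }

    path? : Decidable Path
    path? S = map′ fresh⇒path
                   (λ P → path⇒fresh (steps P) P ≤-refl (allSubsets n) λ {x} _ → allSubsets-complete x)
                   (fresh? _ (allSubsets n) ≤-refl S)

  reconfDist-exists : ∀ {D D′} → Dominating G D → Dominating G D′ → ∃[ d ] ReconfDist G D D′ d
  reconfDist-exists {D} {D′} dom dom′ =
    let k , (1≤k , path) , minimal = least Transforms? (s≤s z≤n , kt-mono (n≤1+n n) (transform-via-⊤ dom dom′))
        m≤k                       = ⊔-lub (proj₂ (kt-first path)) (proj₂ (kt-last path))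
    in k ∸ m , subst Distance (sym (m∸n+n≡m m≤k)) (1≤k , path , λ _ 1≤k′ path′ → minimal (1≤k′ , path′))
    where
    Transforms : ℕ → Set
    Transforms k = 1 ≤ k × KTransforms G k D D′

    Transforms? : Decidable Transforms
    Transforms? k = 1 ≤? k ×-dec Decidability.path? k D′ D

    m : ℕ
    m = ∣ D ∣ ⊔ ∣ D′ ∣

    Distance : ℕ → Set
    Distance k = 1 ≤ k × KTransforms G k D D′ × (∀ k′ → 1 ≤ k′ → KTransforms G k′ D D′ → k ≤ k′)

-- Directions and offsets in the square grid

data Dir : Set where
  right up left down : Dir

directions : List Dir
directions = right ∷ up ∷ left ∷ down ∷ []

∈-directions : ∀ d → d ∈ directions
∈-directions right = here refl
∈-directions up    = there (here refl)
∈-directions left  = there (there (here refl))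
∈-directions down  = there (there (there (here refl)))

directions-unique : Unique directions
directions-unique =
  ((λ ()) ∷ (λ ()) ∷ (λ ()) ∷ []) ∷ ((λ ()) ∷ (λ ()) ∷ []) ∷ ((λ ()) ∷ []) ∷ [] ∷ []

_≟ᵈ_ : DecidableEquality Dir
right ≟ᵈ right = yes refl
right ≟ᵈ up    = no λ ()
right ≟ᵈ left  = no λ ()
right ≟ᵈ down  = no λ ()
up    ≟ᵈ right = no λ ()
up    ≟ᵈ up    = yes refl
up    ≟ᵈ left  = no λ ()
up    ≟ᵈ down  = no λ ()
left  ≟ᵈ right = no λ ()
left  ≟ᵈ up    = no λ ()
left  ≟ᵈ left  = yes refl
left  ≟ᵈ down  = no λ ()
down  ≟ᵈ right = no λ ()
down  ≟ᵈ up    = no λ ()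
down  ≟ᵈ left  = no λ ()
down  ≟ᵈ down  = yes refl

∀-dir? : {P : Dir → Set} → Decidable P → Dec (∀ d → P d)
∀-dir? P? = map′ (λ (r , u , l , d) → λ { right → r ; up → u ; left → l ; down → d })
                 (λ h → h right , h up , h left , h down)
                 (P? right ×-dec P? up ×-dec P? left ×-dec P? down)

opposite rotate : Dir → Dir
opposite right = left
opposite up    = down
opposite left  = right
opposite down  = up
rotate right = up
rotate up    = left
rotate left  = down
rotate down  = right

turn : Dir → Dir
turn d = rotate (opposite d)

opposite-involutive : ∀ d → opposite (opposite d) ≡ d
opposite-involutive right = refl
opposite-involutive up    = refl
opposite-involutive left  = refl
opposite-involutive down  = refl

rotate-injective : ∀ {d d′} → rotate d ≡ rotate d′ → d ≡ d′
rotate-injective {right} {right} _ = refl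
rotate-injective {up}    {up}    _ = refl
rotate-injective {left}  {left}  _ = refl
rotate-injective {down}  {down}  _ = refl

transitive? : (f : Dir → Dir) → Dec (∀ d d′ → ∃ λ (k : Fin 4) → iter f (toℕ k) d ≡ d′)
transitive? f = ∀-dir? λ d → ∀-dir? λ d′ → Fin.any? λ k → iter f (toℕ k) d ≟ᵈ d′

opaque
  rotate-transitive : ∀ d d′ → ∃[ k ] iter rotate k d ≡ d′
  rotate-transitive d d′ = let k , eq = toWitness {a? = transitive? rotate} _ d d′ in toℕ k , eq

  turn-transitive : ∀ d d′ → ∃[ k ] iter turn k d ≡ d′
  turn-transitive d d′ = let k , eq = toWitness {a? = transitive? turn} _ d d′ in toℕ k , eq

Offset : Set
Offset = ℤ × ℤ

_≟ₒ_ : DecidableEquality Offset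
(x , y) ≟ₒ (x′ , y′) =
  map′ (λ (x≡x′ , y≡y′) → cong₂ _,_ x≡x′ y≡y′) (λ { refl → refl , refl }) (x ℤ.≟ x′ ×-dec y ℤ.≟ y′)

open import Data.List.Membership.DecPropositional _≟ₒ_ using () renaming (_∈?_ to _∈ₒ?_)
open import Data.List.Membership.DecPropositional ℤ._≟_ using () renaming (_∈?_ to _∈ℤ?_)

mvₒ : Dir → Offset → Offset
mvₒ right (x , y) = ℤ.suc x , y
mvₒ up    (x , y) = x , ℤ.suc y
mvₒ left  (x , y) = ℤ.pred x , y
mvₒ down  (x , y) = x , ℤ.pred y

closedNbhdₒ : Offset → List Offset
closedNbhdₒ δ = δ ∷ map (λ d → mvₒ d δ) directions

window : ℕ → List ℤ
window r = map (λ i → ℤ.+ i ℤ.- ℤ.+ r) (upTo (suc (r + r)))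

sphere : ℕ → List Offset
sphere r = filter (λ (x , y) → ℤ.∣ x ∣ + ℤ.∣ y ∣ ≟ r) (cartesianProduct (window r) (window r))

-- Listed by increasing norm, so that the local search below fixes the centre first.
ball : ℕ → List Offset
ball zero    = (ℤ.0ℤ , ℤ.0ℤ) ∷ []
ball (suc r) = ball r ++ sphere (suc r)

core? : ∀ δ → Dec (mvₒ right δ ∈ ball 3 × mvₒ up δ ∈ ball 3)
core? δ = mvₒ right δ ∈ₒ? ball 3 ×-dec mvₒ up δ ∈ₒ? ball 3

-- Moved to the right or up, the core stays inside ball 3; it still tells the ten codes apart.
core : List Offset
core = filter core? (ball 3)

module Torus (p-1 : ℕ) where

  p : ℕ
  p = suc p-1

  C : Set
  C = Fin p

  csuc cpred : C → C
  csuc i  = suc (toℕ i) mod p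
  cpred i = (toℕ i + p-1) mod p

  [m%p+k]%p : ∀ m k → (m % p + k) % p ≡ (m + k) % p
  [m%p+k]%p m k = begin
    (m % p + k) % p           ≡⟨ %-distribˡ-+ (m % p) k p ⟩
    (m % p % p + k % p) % p   ≡⟨ cong (λ r → (r + k % p) % p) (m%n%n≡m%n m p) ⟩
    (m % p + k % p) % p       ≡⟨ %-distribˡ-+ m k p ⟨
    (m + k) % p               ∎
    where open ≡-Reasoning

  [1+m%p]%p : ∀ m → suc (m % p) % p ≡ suc m % p
  [1+m%p]%p m = trans (cong (_% p) (+-comm 1 (m % p))) (trans ([m%p+k]%p m 1) (cong (_% p) (+-comm m 1)))

  toℕ-mod : ∀ m → toℕ (m mod p) ≡ m % p
  toℕ-mod m = toℕ-fromℕ< _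

  [i+p]%p≡i : ∀ (i : C) → (toℕ i + p) % p ≡ toℕ i
  [i+p]%p≡i i = trans ([m+n]%n≡m%n (toℕ i) p) (m<n⇒m%n≡m (toℕ<n i))

  csuc-cpred : ∀ i → csuc (cpred i) ≡ i
  csuc-cpred i = toℕ-injective (begin
    toℕ (csuc (cpred i))             ≡⟨ toℕ-mod (suc (toℕ (cpred i))) ⟩
    suc (toℕ (cpred i)) % p          ≡⟨ cong (λ r → suc r % p) (toℕ-mod (toℕ i + p-1)) ⟩
    suc ((toℕ i + p-1) % p) % p      ≡⟨ [1+m%p]%p (toℕ i + p-1) ⟩
    suc (toℕ i + p-1) % p            ≡⟨ cong (_% p) (sym (+-suc (toℕ i) p-1)) ⟩
    (toℕ i + p) % p                  ≡⟨ [i+p]%p≡i i ⟩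
    toℕ i                            ∎)
    where open ≡-Reasoning

  cpred-csuc : ∀ i → cpred (csuc i) ≡ i
  cpred-csuc i = toℕ-injective (begin
    toℕ (cpred (csuc i))             ≡⟨ toℕ-mod (toℕ (csuc i) + p-1) ⟩
    (toℕ (csuc i) + p-1) % p         ≡⟨ cong (λ r → (r + p-1) % p) (toℕ-mod (suc (toℕ i))) ⟩
    (suc (toℕ i) % p + p-1) % p      ≡⟨ [m%p+k]%p (suc (toℕ i)) p-1 ⟩
    (suc (toℕ i) + p-1) % p          ≡⟨ cong (_% p) (sym (+-suc (toℕ i) p-1)) ⟩
    (toℕ i + p) % p                  ≡⟨ [i+p]%p≡i i ⟩
    toℕ i                            ∎)
    where open ≡-Reasoning

  csuc-cpred-comm : ∀ i → csuc (cpred i) ≡ cpred (csuc i)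
  csuc-cpred-comm i = trans (csuc-cpred i) (sym (cpred-csuc i))

  csuc-induction : ∀ {ℓ} (P : C → Set ℓ) → P zero → (∀ i → P i → P (csuc i)) → ∀ i → P i
  csuc-induction P P0 Psuc i = subst P (fromℕ<-toℕ i (toℕ<n i)) (reach (toℕ i) (toℕ<n i))
    where
    reach : ∀ m (m<p : m < p) → P (fromℕ< m<p)
    reach zero    _     = P0
    reach (suc m) 1+m<p = subst P (toℕ-injective (begin
      toℕ (csuc (fromℕ< m<p))          ≡⟨ toℕ-mod (suc (toℕ (fromℕ< m<p))) ⟩
      suc (toℕ (fromℕ< m<p)) % p       ≡⟨ cong (λ r → suc r % p) (toℕ-fromℕ< m<p) ⟩
      suc m % p                        ≡⟨ m<n⇒m%n≡m 1+m<p ⟩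
      suc m                            ≡⟨ toℕ-fromℕ< 1+m<p ⟨
      toℕ (fromℕ< 1+m<p)               ∎)) (Psuc _ (reach m m<p))
      where
      open ≡-Reasoning
      m<p : m < p
      m<p = <-trans (n<1+n m) 1+m<p

  shift : ℤ → C → C
  shift (ℤ.+ k)  = iter csuc k
  shift -[1+ k ] = iter cpred (suc k)

  csuc-shift : ∀ d i → csuc (shift d i) ≡ shift (ℤ.suc d) i
  csuc-shift (ℤ.+ k)      i = refl
  csuc-shift -[1+ zero ]  i = csuc-cpred i
  csuc-shift -[1+ suc k ] i = csuc-cpred _

  cpred-shift : ∀ d i → cpred (shift d i) ≡ shift (ℤ.pred d) i
  cpred-shift (ℤ.+ zero)    i = refl
  cpred-shift (ℤ.+ (suc k)) i = cpred-csuc _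
  cpred-shift -[1+ k ]      i = refl

  shift-csuc : ∀ d i → shift d (csuc i) ≡ csuc (shift d i)
  shift-csuc (ℤ.+ k)  i = sym (iter-hom {f = csuc} {g = csuc} csuc (λ _ → refl) k i)
  shift-csuc -[1+ k ] i = sym (iter-hom {f = cpred} {g = cpred} csuc csuc-cpred-comm (suc k) i)

  shift-cpred : ∀ d i → shift d (cpred i) ≡ cpred (shift d i)
  shift-cpred (ℤ.+ k)  i = sym (iter-hom {f = csuc} {g = csuc} cpred (sym ∘ csuc-cpred-comm) k i)
  shift-cpred -[1+ k ] i = sym (iter-hom {f = cpred} {g = cpred} cpred (λ _ → refl) (suc k) i)

  shift-neg : ∀ d i → shift (ℤ.- d) (shift d i) ≡ i
  shift-neg (ℤ.+ zero)    i = refl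
  shift-neg (ℤ.+ (suc k)) i = iter-inverse {f = csuc} {g = cpred} cpred-csuc (suc k) i
  shift-neg -[1+ k ]      i = iter-inverse {f = cpred} {g = csuc} csuc-cpred (suc k) i

  V : Set
  V = C × C

  mv : Dir → V → V
  mv right (x , y) = csuc x , y
  mv up    (x , y) = x , csuc y
  mv left  (x , y) = cpred x , y
  mv down  (x , y) = x , cpred y

  mv-opposite : ∀ d a → mv (opposite d) (mv d a) ≡ a
  mv-opposite right (x , y) = cong (_, y) (cpred-csuc x)
  mv-opposite up    (x , y) = cong (x ,_) (cpred-csuc y)
  mv-opposite left  (x , y) = cong (_, y) (csuc-cpred x)
  mv-opposite down  (x , y) = cong (x ,_) (csuc-cpred y)

  mv-opposite⁻ : ∀ d a → mv d (mv (opposite d) a) ≡ a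
  mv-opposite⁻ d a = subst (λ e → mv e (mv (opposite d) a) ≡ a) (opposite-involutive d) (mv-opposite (opposite d) a)

  mv-cancel : ∀ d {a b} → mv d a ≡ mv d b → a ≡ b
  mv-cancel d {a} {b} eq = trans (sym (mv-opposite d a)) (trans (cong (mv (opposite d)) eq) (mv-opposite d b))

  _⊕_ : V → Offset → V
  (x , y) ⊕ (dx , dy) = shift dx x , shift dy y

  ⊕-mvₒ : ∀ a d δ → a ⊕ mvₒ d δ ≡ mv d (a ⊕ δ)
  ⊕-mvₒ (x , y) right (dx , dy) = cong (_, _) (sym (csuc-shift dx x))
  ⊕-mvₒ (x , y) up    (dx , dy) = cong (_ ,_) (sym (csuc-shift dy y))
  ⊕-mvₒ (x , y) left  (dx , dy) = cong (_, _) (sym (cpred-shift dx x))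
  ⊕-mvₒ (x , y) down  (dx , dy) = cong (_ ,_) (sym (cpred-shift dy y))

  mv-⊕ : ∀ a d δ → mv d a ⊕ δ ≡ a ⊕ mvₒ d δ
  mv-⊕ (x , y) right (dx , dy) = cong (_, _) (trans (shift-csuc dx x) (csuc-shift dx x))
  mv-⊕ (x , y) up    (dx , dy) = cong (_ ,_) (trans (shift-csuc dy y) (csuc-shift dy y))
  mv-⊕ (x , y) left  (dx , dy) = cong (_, _) (trans (shift-cpred dx x) (cpred-shift dx x))
  mv-⊕ (x , y) down  (dx , dy) = cong (_ ,_) (trans (shift-cpred dy y) (cpred-shift dy y))

  closedNbhd : V → List V
  closedNbhd a = a ∷ map (λ d → mv d a) directions

  cover : (V → Bool) → V → ℕ
  cover f a = count f (closedNbhd a)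

  ⊕-closedNbhd : ∀ a δ → map (a ⊕_) (closedNbhdₒ δ) ≡ closedNbhd (a ⊕ δ)
  ⊕-closedNbhd a δ = cong ((a ⊕ δ) ∷_)
    (trans (sym (map-∘ {g = a ⊕_} {f = λ d → mvₒ d δ} directions)) (map-cong (λ d → ⊕-mvₒ a d δ) directions))


module Covering (m-1 p-1 : ℕ) (m∣p : suc m-1 ∣ suc p-1) where

  private
    module Tₘ = Torus m-1
    module Tₚ = Torus p-1

  reduce : Tₚ.C → Tₘ.C
  reduce i = toℕ i mod Tₘ.p

  reduce-csuc : ∀ i → reduce (Tₚ.csuc i) ≡ Tₘ.csuc (reduce i)
  reduce-csuc i = toℕ-injective (begin
    toℕ (reduce (Tₚ.csuc i))              ≡⟨ Tₘ.toℕ-mod (toℕ (Tₚ.csuc i)) ⟩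
    toℕ (Tₚ.csuc i) % Tₘ.p                ≡⟨ cong (_% Tₘ.p) (Tₚ.toℕ-mod (suc (toℕ i))) ⟩
    suc (toℕ i) % Tₚ.p % Tₘ.p             ≡⟨ m∣n⇒o%n%m≡o%m Tₘ.p Tₚ.p (suc (toℕ i)) m∣p ⟩
    suc (toℕ i) % Tₘ.p                    ≡⟨ Tₘ.[1+m%p]%p (toℕ i) ⟨
    suc (toℕ i % Tₘ.p) % Tₘ.p             ≡⟨ cong (λ r → suc r % Tₘ.p) (Tₘ.toℕ-mod (toℕ i)) ⟨
    suc (toℕ (reduce i)) % Tₘ.p           ≡⟨ Tₘ.toℕ-mod (suc (toℕ (reduce i))) ⟨
    toℕ (Tₘ.csuc (reduce i))              ∎)
    where open ≡-Reasoning

  reduce-cpred : ∀ i → reduce (Tₚ.cpred i) ≡ Tₘ.cpred (reduce i)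
  reduce-cpred i = begin
    reduce (Tₚ.cpred i)                       ≡⟨ Tₘ.cpred-csuc _ ⟨
    Tₘ.cpred (Tₘ.csuc (reduce (Tₚ.cpred i)))  ≡⟨ cong Tₘ.cpred (reduce-csuc (Tₚ.cpred i)) ⟨
    Tₘ.cpred (reduce (Tₚ.csuc (Tₚ.cpred i)))  ≡⟨ cong (Tₘ.cpred ∘ reduce) (Tₚ.csuc-cpred i) ⟩
    Tₘ.cpred (reduce i)                       ∎
    where open ≡-Reasoning

  reduce-shift : ∀ d i → reduce (Tₚ.shift d i) ≡ Tₘ.shift d (reduce i)
  reduce-shift (ℤ.+ k)  i = iter-hom {f = Tₚ.csuc} {g = Tₘ.csuc} reduce reduce-csuc k i
  reduce-shift -[1+ k ] i = iter-hom {f = Tₚ.cpred} {g = Tₘ.cpred} reduce reduce-cpred (suc k) i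

  π : Tₚ.V → Tₘ.V
  π (x , y) = reduce x , reduce y

  π-mv : ∀ d a → π (Tₚ.mv d a) ≡ Tₘ.mv d (π a)
  π-mv right (x , y) = cong (_, _) (reduce-csuc x)
  π-mv up    (x , y) = cong (_ ,_) (reduce-csuc y)
  π-mv left  (x , y) = cong (_, _) (reduce-cpred x)
  π-mv down  (x , y) = cong (_ ,_) (reduce-cpred y)

  π-⊕ : ∀ a δ → π (a Tₚ.⊕ δ) ≡ π a Tₘ.⊕ δ
  π-⊕ (x , y) (dx , dy) = cong₂ _,_ (reduce-shift dx x) (reduce-shift dy y)


  π-closedNbhd : ∀ a → map π (Tₚ.closedNbhd a) ≡ Tₘ.closedNbhd (π a)
  π-closedNbhd a = cong (π a ∷_)
    (trans (sym (map-∘ {g = π} {f = λ d → Tₚ.mv d a} directions)) (map-cong (λ d → π-mv d a) directions))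

module _ {m n} {P : Fin m × Fin n → Set} (P? : Decidable P) where

  ∀-pair? : Dec (∀ a → P a)
  ∀-pair? = map′ (λ h (x , y) → h x y) (λ h x y → h (x , y)) (Fin.all? λ x → Fin.all? λ y → P? (x , y))

  ∃-pair? : Dec (∃ P)
  ∃-pair? = map′ (λ (x , y , pxy) → (x , y) , pxy) (λ ((x , y) , pxy) → x , y , pxy)
                 (Fin.any? λ x → Fin.any? λ y → P? (x , y))

-- The facts about this finite torus are exhaustive checks; they are opaque so that the type checker
-- never unfolds them again where they are used.
module Torus₅ where

  open Torus 4

  opaque
    mv-injective₅ : ∀ a d d′ → mv d a ≡ mv d′ a → d ≡ d′
    mv-injective₅ = toWitness {a? = ∀-pair? λ a → ∀-dir? λ d → ∀-dir? λ d′ →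
                                     ≡-dec Fin._≟_ Fin._≟_ (mv d a) (mv d′ a) →-dec d ≟ᵈ d′} _

    mv-irreflexive₅ : ∀ a d → mv d a ≢ a
    mv-irreflexive₅ = toWitness {a? = ∀-pair? λ a → ∀-dir? λ d → ¬? (≡-dec Fin._≟_ Fin._≟_ (mv d a) a)} _

  Code : Set
  Code = Fin 5 × Fin 2

  _≟ᶜ_ : DecidableEquality Code
  _≟ᶜ_ = ≡-dec Fin._≟_ Fin._≟_

  codes : List Code
  codes = cartesianProduct (allFin 5) (allFin 2)

  inCode : Code → V → Bool
  inCode (c , s) (x , y) = (toℕ x + (2 + toℕ s) * toℕ y + toℕ c) % 5 ≡ᵇ 0

  origin : V
  origin = zero , zero

  -- The checks below abstract over the list of offsets so that the evaluator computes it only once.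
  opaque
    code-perfect : ∀ i a → cover (inCode i) a ≡ 1
    code-perfect = toWitness {a? = ∀-pair? λ i → ∀-pair? λ a → cover (inCode i) a ≟ 1} tt

    code-translate : ∀ i a → ∃[ j ] All (λ δ → inCode j (a ⊕ δ) ≡ inCode i (origin ⊕ δ)) (ball 3)
    code-translate = toWitness {a? = translate? (ball 3)} tt
      where
      translate? : ∀ B → Dec (∀ i a → ∃[ j ] All (λ δ → inCode j (a ⊕ δ) ≡ inCode i (origin ⊕ δ)) B)
      translate? B = ∀-pair? λ i → ∀-pair? λ a → ∃-pair? λ j →
                     All.all? (λ δ → inCode j (a ⊕ δ) Bool.≟ inCode i (origin ⊕ δ)) B

    code-unique : ∀ a i j → All (λ δ → inCode i (a ⊕ δ) ≡ inCode j (a ⊕ δ)) core → i ≡ j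
    code-unique = toWitness {a? = unique? core} tt
      where
      unique? : ∀ K → Dec (∀ a i j → All (λ δ → inCode i (a ⊕ δ) ≡ inCode j (a ⊕ δ)) K → i ≡ j)
      unique? K = ∀-pair? λ a → ∀-pair? λ i → ∀-pair? λ j →
                  All.all? (λ δ → inCode i (a ⊕ δ) Bool.≟ inCode j (a ⊕ δ)) K →-dec i ≟ᶜ j

  LocallyPerfect : (Offset → Bool) → Set
  LocallyPerfect f = All (λ δ → count f (closedNbhdₒ δ) ≡ 1) (ball 2)

  MatchesCode : (Offset → Bool) → Set
  MatchesCode f = ∃[ i ] All (λ δ → f δ ≡ inCode i (origin ⊕ δ)) (ball 3)

  open PrunedSearch _≟ₒ_

  violated : Assignment → List Offset → Bool
  violated σ N = (2 ≤ᵇ count (known true ∘ valueOf σ) N) ∨ all (known false ∘ valueOf σ) N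

  -- Only the constraints through the cell assigned last can have become violated.
  refuteIn : List Offset → Assignment → Bool
  refuteIn B []              = false
  refuteIn B σ@((a , _) ∷ _) = any (λ δ → does (a ∈ₒ? closedNbhdₒ δ) ∧ violated σ (closedNbhdₒ δ)) B

  acceptIn : List Offset → Assignment → Bool
  acceptIn B σ = any (λ i → all (λ δ → known (inCode i (origin ⊕ δ)) (valueOf σ δ)) B) codes

  violated-sound : ∀ {f σ N} → Consistent f σ → T (violated σ N) → count f N ≢ 1
  violated-sound {f} {σ} {N} f∼σ v with Equivalence.to T-∨ v
  ... | inj₁ 2≤trues = λ count≡1 →
    <⇒≱ (≤-trans (≤ᵇ⇒≤ 2 _ 2≤trues) (count-mono trues⇒f N)) (≤-reflexive count≡1)
    where
    trues⇒f : ∀ a → T (known true (valueOf σ a)) → T (f a)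
    trues⇒f a k = subst T (sym (known-sound true f∼σ k)) tt
  ... | inj₂ allFalse = λ count≡1 →
    0≢1+n (trans (sym (count-none (All.map (known-sound false f∼σ) (all⁺ _ N allFalse)))) count≡1)

  refute-sound : ∀ {f σ} → Consistent f σ → T (refuteIn (ball 2) σ) → ¬ LocallyPerfect f
  refute-sound {f} {σ@((a , _) ∷ _)} f∼σ r perfect = All¬⇒¬Any (All.map not-violated perfect) (any⁻ _ (ball 2) r)
    where
    not-violated : ∀ {δ} → count f (closedNbhdₒ δ) ≡ 1 →
                   ¬ T (does (a ∈ₒ? closedNbhdₒ δ) ∧ violated σ (closedNbhdₒ δ))
    not-violated {δ} count≡1 v =
      violated-sound {N = closedNbhdₒ δ} f∼σ (T-∧-proj₂ {does (a ∈ₒ? closedNbhdₒ δ)} v) count≡1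

  accept-sound : ∀ {f σ} → Consistent f σ → T (acceptIn (ball 3) σ) → LocallyPerfect f → MatchesCode f
  accept-sound f∼σ a _ with satisfied (any⁻ _ codes a)
  ... | i , matches = i , All.map (known-sound _ f∼σ) (all⁺ _ (ball 3) matches)

  opaque
    local-rigidity : ∀ f → LocallyPerfect f → MatchesCode f
    local-rigidity f = search-sound refute-sound accept-sound (ball 3) [] tt

module Grid (p-1 : ℕ) (5∣p : 5 ∣ suc p-1) where

  open Torus p-1 public
  open Covering 4 p-1 5∣p public using (π; π-mv; π-⊕; π-closedNbhd)

  N : ℕ
  N = p * p

  -- Opaque: unfolding remQuot derails unification with decoded vertices.
  opaque
    enc : V → Fin N
    enc (x , y) = Fin.combine x y

    dec : Fin N → V
    dec = Fin.remQuot p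

    dec-enc : ∀ a → dec (enc a) ≡ a
    dec-enc (x , y) = Fin.remQuot-combine x y

    enc-dec : ∀ w → enc (dec w) ≡ w
    enc-dec = Fin.combine-remQuot p

  enc-injective : ∀ {a b} → enc a ≡ enc b → a ≡ b
  enc-injective {a} {b} eq = trans (sym (dec-enc a)) (trans (cong dec eq) (dec-enc b))

  -- The four neighbours are distinct because their images in the 5 × 5 torus are.
  mv-injective : ∀ a {d d′} → mv d a ≡ mv d′ a → d ≡ d′
  mv-injective a {d} {d′} eq =
    Torus₅.mv-injective₅ (π a) d d′ (trans (sym (π-mv d a)) (trans (cong π eq) (π-mv d′ a)))

  mv-irreflexive : ∀ a d → mv d a ≢ a
  mv-irreflexive a d eq = Torus₅.mv-irreflexive₅ (π a) d (trans (sym (π-mv d a)) (cong π eq))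

  neighbours : Fin N → List (Fin N)
  neighbours w = map (λ d → enc (mv d (dec w))) directions

  open import Data.List.Membership.DecPropositional (Fin._≟_ {N}) using (_∈?_)

  ∈-neighbours⁻ : ∀ {v w} → v ∈ neighbours w → ∃[ d ] v ≡ enc (mv d (dec w))
  ∈-neighbours⁻ {w = w} v∈ = let d , _ , eq = ∈-map⁻ (λ d → enc (mv d (dec w))) {xs = directions} v∈ in d , eq

  ∈-neighbours⁺ : ∀ d w → enc (mv d (dec w)) ∈ neighbours w
  ∈-neighbours⁺ d w = ∈-map⁺ (λ d → enc (mv d (dec w))) (∈-directions d)

  neighbours-sym : ∀ {v w} → v ∈ neighbours w → w ∈ neighbours v
  neighbours-sym {v} {w} v∈ with ∈-neighbours⁻ v∈
  ... | d , refl = subst (_∈ neighbours v) w≡ (∈-neighbours⁺ (opposite d) v)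
    where
    w≡ : enc (mv (opposite d) (dec v)) ≡ w
    w≡ = trans (cong (enc ∘ mv (opposite d)) (dec-enc _)) (trans (cong enc (mv-opposite d (dec w))) (enc-dec w))

  neighbours-irreflexive : ∀ w → ¬ (w ∈ neighbours w)
  neighbours-irreflexive w w∈ with ∈-neighbours⁻ w∈
  ... | d , eq = mv-irreflexive (dec w) d (sym (trans (cong dec eq) (dec-enc _)))

  G : Graph N
  G = record
    { adj    = λ u v → does (v ∈? neighbours u)
    ; sym    = λ u v → does-⇔ (mk⇔ neighbours-sym neighbours-sym) (v ∈? neighbours u) (u ∈? neighbours v)
    ; irrefl = λ v → dec-false (v ∈? neighbours v) (neighbours-irreflexive v)
    }

  adjacent⁻ : ∀ {u v} → u ~[ G ] v → ∃[ d ] v ≡ enc (mv d (dec u))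
  adjacent⁻ {u} {v} u~v = ∈-neighbours⁻ (does-true (v ∈? neighbours u) u~v)

  adjacent⁺ : ∀ d u → u ~[ G ] enc (mv d (dec u))
  adjacent⁺ d u = dec-true (_ ∈? neighbours u) (∈-neighbours⁺ d u)

  mv-adjacent : ∀ d a → enc a ~[ G ] enc (mv d a)
  mv-adjacent d a = subst (λ b → enc a ~[ G ] enc (mv d b)) (dec-enc a) (adjacent⁺ d (enc a))

  regular : Regular 4 G
  regular v = trans (listSum-allFin (𝟙 ∘ adj G v)) (sum-𝟙-∈ neighbours-unique)
    where
    neighbours-unique : Unique (neighbours v)
    neighbours-unique = Unique.map⁺ (λ eq → mv-injective (dec v) (enc-injective eq)) directions-unique

module Embedding (p-1 : ℕ) (5∣p : 5 ∣ suc p-1) where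

  open Grid p-1 5∣p

  _≟ᵥ_ : DecidableEquality V
  _≟ᵥ_ = ≡-dec Fin._≟_ Fin._≟_

  direction : V → V → Dir
  direction a b with Any.any? (λ d → b ≟ᵥ mv d a) directions
  ... | yes found = proj₁ (satisfied found)
  ... | no  _     = right

  direction-mv : ∀ a d → direction a (mv d a) ≡ d
  direction-mv a d with Any.any? (λ d′ → mv d a ≟ᵥ mv d′ a) directions
  ... | yes found = sym (mv-injective a (proj₂ (satisfied found)))
  ... | no  none  = contradiction (Any.map (λ { refl → refl }) (∈-directions d)) none

  σG : Fin N → Fin N → Fin N
  σG v u = enc (mv (rotate (direction (dec v) (dec u))) (dec v))

  σG-mv : ∀ v d → σG v (enc (mv d (dec v))) ≡ enc (mv (rotate d) (dec v))
  σG-mv v d rewrite dec-enc (mv d (dec v)) | direction-mv (dec v) d = refl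

  σG-mv-enc : ∀ a d → σG (enc a) (enc (mv d a)) ≡ enc (mv (rotate d) a)
  σG-mv-enc a d rewrite dec-enc a | dec-enc (mv d a) | direction-mv a d = refl

  iter-σG : ∀ v d k → iter (σG v) k (enc (mv d (dec v))) ≡ enc (mv (iter rotate k d) (dec v))
  iter-σG v d k = sym (iter-hom {f = rotate} {g = σG v} (λ d → enc (mv d (dec v))) (λ d → sym (σG-mv v d)) k d)

  ~-sym : ∀ {u v} → u ~[ G ] v → v ~[ G ] u
  ~-sym {u} {v} u~v = trans (Graph.sym G v u) u~v

  σG-closed : ∀ v u → v ~[ G ] u → v ~[ G ] σG v u
  σG-closed v u v~u with adjacent⁻ {v} {u} v~u
  ... | d , refl = subst (v ~[ G ]_) (sym (σG-mv v d)) (adjacent⁺ (rotate d) v)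

  σG-injective : ∀ v u w → v ~[ G ] u → v ~[ G ] w → σG v u ≡ σG v w → u ≡ w
  σG-injective v u w v~u v~w eq with adjacent⁻ {v} {u} v~u | adjacent⁻ {v} {w} v~w
  ... | d , refl | d′ , refl = cong (λ e → enc (mv e (dec v))) (rotate-injective (mv-injective (dec v)
          (enc-injective (trans (sym (σG-mv v d)) (trans eq (σG-mv v d′))))))

  σG-cyclic : ∀ v u w → v ~[ G ] u → v ~[ G ] w → ∃[ k ] iter (σG v) k u ≡ w
  σG-cyclic v u w v~u v~w with adjacent⁻ {v} {u} v~u | adjacent⁻ {v} {w} v~w
  ... | d , refl | d′ , refl with rotate-transitive d d′
  ...   | k , eq = k , trans (iter-σG v d k) (cong (λ e → enc (mv e (dec v))) eq)

  rotation : RotationSystem G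
  rotation = record { σ = σG ; closed = σG-closed ; inj = σG-injective ; cyc = σG-cyclic }

  dart : V × Dir → Fin N × Fin N
  dart (a , d) = enc a , enc (mv d a)

  as-dart : ∀ {u v} → u ~[ G ] v → ∃[ d ] (u , v) ≡ dart (dec u , d)
  as-dart {u} {v} u~v with adjacent⁻ {u} {v} u~v
  ... | d , refl = d , cong (_, enc (mv d (dec u))) (sym (enc-dec u))

  dartStep : V × Dir → V × Dir
  dartStep (a , d) = mv d a , turn d

  faceStep-dart : ∀ s → faceStep rotation (dart s) ≡ dart (dartStep s)
  faceStep-dart (a , d) = cong (enc (mv d a) ,_) (begin
    σG (enc (mv d a)) (enc a)                            ≡⟨ cong (σG (enc (mv d a)) ∘ enc) (mv-opposite d a) ⟨
    σG (enc (mv d a)) (enc (mv (opposite d) (mv d a)))   ≡⟨ σG-mv-enc (mv d a) (opposite d) ⟩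
    enc (mv (turn d) (mv d a))                           ∎)
    where open ≡-Reasoning

  -- The face traced from a dart is a unit square; this is its lower-left corner.
  square : V × Dir → V
  square (a , right) = mv down a
  square (a , up)    = a
  square (a , left)  = mv left a
  square (a , down)  = mv left (mv down a)

  square-dartStep : ∀ s → square (dartStep s) ≡ square s
  square-dartStep ((x , y) , right) = cong (_, cpred y) (cpred-csuc x)
  square-dartStep ((x , y) , up)    = cong (x ,_) (cpred-csuc y)
  square-dartStep (a , left)        = refl
  square-dartStep (a , down)        = refl

  square-injective : ∀ d {a b} → square (a , d) ≡ square (b , d) → a ≡ b
  square-injective right = mv-cancel down
  square-injective up    = id
  square-injective left  = mv-cancel left
  square-injective down  = mv-cancel down ∘ mv-cancel left

  faceOf : Fin N × Fin N → Fin N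
  faceOf (u , v) = enc (square (dec u , direction (dec u) (dec v)))

  faceOf-dart : ∀ s → faceOf (dart s) ≡ enc (square s)
  faceOf-dart (a , d) rewrite dec-enc a | dec-enc (mv d a) | direction-mv a d = refl

  sameFace-snoc : ∀ {s s′} → SameFace rotation s s′ → SameFace rotation s (faceStep rotation s′)
  sameFace-snoc here      = next here
  sameFace-snoc (next sf) = next (sameFace-snoc sf)

  sameFace-iter : ∀ k s → SameFace rotation s (iter (faceStep rotation) k s)
  sameFace-iter zero    s = here
  sameFace-iter (suc k) s = sameFace-snoc (sameFace-iter k s)

  sameFace-darts : ∀ s s′ → square s ≡ square s′ → SameFace rotation (dart s) (dart s′)
  sameFace-darts s (a′ , d′) eq with turn-transitive (proj₂ s) d′
  ... | k , turns = subst (SameFace rotation (dart s)) walked (sameFace-iter k (dart s))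
    where
    reached : iter dartStep k s ≡ (a′ , d′)
    reached with iter dartStep k s | iter-hom {f = dartStep} {g = turn} proj₂ (λ _ → refl) k s
               | iter-invariant {f = dartStep} square square-dartStep k s
    ... | b , e | e≡ | sq with trans e≡ turns
    ...   | refl = cong (_, d′) (square-injective d′ (trans sq eq))
    walked : iter (faceStep rotation) k (dart s) ≡ dart (a′ , d′)
    walked = trans (sym (iter-hom {f = dartStep} {g = faceStep rotation} dart (sym ∘ faceStep-dart) k s)) (cong dart reached)

  faceOf-faceStep : ∀ {u v} → u ~[ G ] v → faceOf (faceStep rotation (u , v)) ≡ faceOf (u , v)
  faceOf-faceStep {u} {v} u~v with as-dart {u} {v} u~v
  ... | d , eq = begin
    faceOf (faceStep rotation (u , v))    ≡⟨ cong (faceOf ∘ faceStep rotation) eq ⟩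
    faceOf (faceStep rotation (dart s))   ≡⟨ cong faceOf (faceStep-dart s) ⟩
    faceOf (dart (dartStep s))            ≡⟨ faceOf-dart (dartStep s) ⟩
    enc (square (dartStep s))             ≡⟨ cong enc (square-dartStep s) ⟩
    enc (square s)                        ≡⟨ faceOf-dart s ⟨
    faceOf (dart s)                       ≡⟨ cong faceOf eq ⟨
    faceOf (u , v)                        ∎
    where
    open ≡-Reasoning
    s = dec u , d

  faceOf-sameFace : ∀ {u v t} → u ~[ G ] v → SameFace rotation (u , v) t → faceOf (u , v) ≡ faceOf t
  faceOf-sameFace u~v here              = refl
  faceOf-sameFace {u} {v} u~v (next sf) =
    trans (sym (faceOf-faceStep {u} {v} u~v)) (faceOf-sameFace {v} {σG v u} (σG-closed v u (~-sym {u} {v} u~v)) sf)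

  faces : FaceCount rotation N
  faces = (λ u v → faceOf (u , v))
        , (λ u v u′ v′ u~v u′~v′ → sameFace⇐ u~v u′~v′ , faceOf-sameFace {u} {v} u~v)
        , onto
    where
    sameFace⇐ : ∀ {u v u′ v′} → u ~[ G ] v → u′ ~[ G ] v′ →
                faceOf (u , v) ≡ faceOf (u′ , v′) → SameFace rotation (u , v) (u′ , v′)
    sameFace⇐ {u} {v} {u′} {v′} u~v u′~v′ eq with as-dart {u} {v} u~v | as-dart {u′} {v′} u′~v′
    ... | d , e | d′ , e′ = subst₂ (SameFace rotation) (sym e) (sym e′) (sameFace-darts _ _ (enc-injective
          (trans (sym (faceOf-dart _)) (trans (cong faceOf (sym e)) (trans eq (trans (cong faceOf e′) (faceOf-dart _)))))))
    onto : ∀ i → ∃[ u ] ∃[ v ] (u ~[ G ] v × faceOf (u , v) ≡ i)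
    onto i = enc (dec i) , enc (mv up (dec i)) , mv-adjacent up (dec i) , trans (faceOf-dart (dec i , up)) (enc-dec i)

  reach-trans : ∀ {u v w} → Reach G u v → Reach G v w → Reach G u w
  reach-trans here         r = r
  reach-trans (step u~ r′) r = step u~ (reach-trans r′ r)

  reach-sym : ∀ {u v} → Reach G u v → Reach G v u
  reach-sym here                     = here
  reach-sym (step {u} {v} u~v r) = reach-trans (reach-sym r) (step (~-sym {u} {v} u~v) here)

  reach-origin : ∀ a → Reach G (enc a) (enc (zero , zero))
  reach-origin (x , y) = reach-trans (along-row x) (along-column y)
    where
    along-row : ∀ x → Reach G (enc (x , y)) (enc (zero , y))
    along-row = csuc-induction _ here λ x r →
      step (mv-adjacent left (csuc x , y)) (subst (λ x′ → Reach G (enc (x′ , y)) _) (sym (cpred-csuc x)) r)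
    along-column : ∀ y → Reach G (enc (zero , y)) (enc (zero , zero))
    along-column = csuc-induction _ here λ y r →
      step (mv-adjacent down (zero , csuc y)) (subst (λ y′ → Reach G (enc (zero , y′)) _) (sym (cpred-csuc y)) r)

  connected : ComponentCount G 1
  connected = (λ _ → zero) , (λ u v → (λ _ → reach u v) , (λ _ → refl)) , λ { zero → zero , refl }
    where
    reach : ∀ u v → Reach G u v
    reach u v = subst₂ (Reach G) (enc-dec u) (enc-dec v)
                       (reach-trans (reach-origin (dec u)) (reach-sym (reach-origin (dec v))))

  degSum≡ : degSum G ≡ N * 4
  degSum≡ = trans (listSum-allFin (deg G)) (trans (sum-cong-≗ regular) (sum-const N 4))

  isolated≡0 : isolated G ≡ 0
  isolated≡0 = trans (listSum-allFin (λ v → if deg G v ≡ᵇ 0 then 1 else 0))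
                     (trans (sum-cong-≗ (λ v → cong (λ k → if k ≡ᵇ 0 then 1 else 0) (regular v))) (sum-zero N))

  -- The N squares are the faces, so n(G) − |E(G)| + #faces = N − 2N + N = 0.
  embeds : EmbedsOnTorus G
  embeds = rotation , N , 1 , faces , connected , ≤-reflexive (begin
    degSum G + 4 * 1                   ≡⟨ cong (_+ 4 * 1) degSum≡ ⟩
    N * 4 + 4 * 1                      ≡⟨ euler N ⟩
    2 * N + 2 * (N + 0) + 4            ≡⟨ cong (λ k → 2 * N + 2 * (N + k) + 4) isolated≡0 ⟨
    2 * N + 2 * (N + isolated G) + 4   ∎)
    where
    open ≡-Reasoning
    euler : ∀ n → n * 4 + 4 * 1 ≡ 2 * n + 2 * (n + 0) + 4
    euler = solve-∀

module Domination (p-1 : ℕ) (5∣p : 5 ∣ suc p-1) where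

  open Grid p-1 5∣p
  open Torus₅ using (Code; inCode; code-perfect)
  private module T₅ = Torus 4

  member : Subset N → V → Bool
  member S a = lookup S (enc a)

  coverage : Subset N → V → ℕ
  coverage S = cover (member S)

  move : Maybe Dir → V → V
  move nothing  = id
  move (just d) = mv d

  dominating⇒covered : ∀ S → Dominating G S → ∀ a → 1 ≤ coverage S a
  dominating⇒covered S dom a with dom (enc a)
  ... | inj₁ a∈S = count-pos⁺ (member S) {xs = closedNbhd a} (here refl) ([]=⇒lookup a∈S)
  ... | inj₂ (u , a~u , u∈S) with adjacent⁻ {enc a} {u} a~u
  ...   | d , refl = count-pos⁺ (member S) (there (∈-map⁺ (λ d → mv d a) (∈-directions d)))
                       (subst (λ b → lookup S (enc (mv d b)) ≡ true) (dec-enc a) ([]=⇒lookup u∈S))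

  covered⇒dominating : ∀ {S} → (∀ a → 1 ≤ coverage S a) → Dominating G S
  covered⇒dominating {S} covered v with count-pos⁻ (member S) (closedNbhd (dec v)) (covered (dec v))
  ... | _ , here refl , Sv = inj₁ (lookup⇒[]= v S (subst (λ w → lookup S w ≡ true) (enc-dec v) Sv))
  ... | _ , there b∈ , Sb with ∈-map⁻ (λ d → mv d (dec v)) {xs = directions} b∈
  ...   | d , _ , refl = inj₂ (enc (mv d (dec v)) , adjacent⁺ d v , lookup⇒[]= _ S Sb)

  sum-bijection : ∀ (f : Fin N → ℕ) (m m⁻ : V → V) → (∀ a → m (m⁻ a) ≡ a) → (∀ a → m⁻ (m a) ≡ a) →
                  sum (λ w → f (enc (m (dec w)))) ≡ sum f
  sum-bijection f m m⁻ m∘m⁻ m⁻∘m = sym (sum-permute f (permutation to from to∘from from∘to))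
    where
    to from : Fin N → Fin N
    to   w = enc (m (dec w))
    from w = enc (m⁻ (dec w))
    to∘from : ∀ w → to (from w) ≡ w
    to∘from w = trans (cong (enc ∘ m) (dec-enc _)) (trans (cong enc (m∘m⁻ (dec w))) (enc-dec w))
    from∘to : ∀ w → from (to w) ≡ w
    from∘to w = trans (cong (enc ∘ m⁻) (dec-enc _)) (trans (cong enc (m⁻∘m (dec w))) (enc-dec w))

  sum-coverage : ∀ S → sum (λ w → coverage S (dec w)) ≡ 5 * ∣ S ∣
  sum-coverage S = begin
    sum (λ w → coverage S (dec w))
      ≡⟨ sum-listSum (λ w o → 𝟙 (member S (move o (dec w)))) moves ⟩
    listSum (map (λ o → sum (λ w → 𝟙 (member S (move o (dec w))))) moves)
      ≡⟨ cong listSum (map-cong each-move moves) ⟩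
    listSum (map (λ _ → ∣ S ∣) moves)
      ≡⟨⟩
    5 * ∣ S ∣ ∎
    where
    open ≡-Reasoning
    moves = nothing ∷ map just directions
    each-move : ∀ o → sum (λ w → 𝟙 (member S (move o (dec w)))) ≡ ∣ S ∣
    each-move nothing  = trans (sum-bijection (𝟙 ∘ lookup S) id id (λ _ → refl) (λ _ → refl)) (sym (∣p∣≡sum S))
    each-move (just d) =
      trans (sum-bijection (𝟙 ∘ lookup S) (mv d) (mv (opposite d)) (mv-opposite⁻ d) (mv-opposite d)) (sym (∣p∣≡sum S))

  overcovered : Subset N → List (Fin N)
  overcovered S = filter (λ w → 2 ≤? coverage S (dec w)) (allFin N)

  overcovered-bound : ∀ {S} → Dominating G S → N + length (overcovered S) ≤ 5 * ∣ S ∣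
  overcovered-bound {S} dom = begin
    N + length (overcovered S)
      ≡⟨ cong (N +_) (trans (length-filter (λ w → 2 ≤? coverage S (dec w)) (allFin N))
                            (listSum-allFin (λ w → 𝟙 (does (2 ≤? coverage S (dec w)))))) ⟩
    N + sum (λ w → 𝟙 (does (2 ≤? coverage S (dec w))))
      ≤⟨ sum-excess (λ w → coverage S (dec w)) (λ w → dominating⇒covered S dom (dec w)) ⟩
    sum (λ w → coverage S (dec w))
      ≡⟨ sum-coverage S ⟩
    5 * ∣ S ∣ ∎
    where open ≤-Reasoning

  codeSet : Code → Subset N
  codeSet i = Vec.tabulate (λ w → inCode i (π (dec w)))

  member-codeSet : ∀ i a → member (codeSet i) a ≡ inCode i (π a)
  member-codeSet i a = trans (lookup∘tabulate (λ w → inCode i (π (dec w))) (enc a)) (cong (inCode i ∘ π) (dec-enc a))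

  coverage-codeSet : ∀ i a → coverage (codeSet i) a ≡ 1
  coverage-codeSet i a = begin
    count (member (codeSet i)) (closedNbhd a)    ≡⟨ count-cong (member-codeSet i) (closedNbhd a) ⟩
    count (inCode i ∘ π) (closedNbhd a)          ≡⟨ count-map (inCode i) π (closedNbhd a) ⟨
    count (inCode i) (map π (closedNbhd a))      ≡⟨ cong (count (inCode i)) (π-closedNbhd a) ⟩
    count (inCode i) (T₅.closedNbhd (π a))       ≡⟨ code-perfect i (π a) ⟩
    1                                            ∎
    where open ≡-Reasoning

  codeSet-dominating : ∀ i → Dominating G (codeSet i)
  codeSet-dominating i = covered⇒dominating (λ a → ≤-reflexive (sym (coverage-codeSet i a)))

  codeSet-size : ∀ i → ∣ codeSet i ∣ * 5 ≡ N
  codeSet-size i = begin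
    ∣ codeSet i ∣ * 5                          ≡⟨ *-comm ∣ codeSet i ∣ 5 ⟩
    5 * ∣ codeSet i ∣                          ≡⟨ sum-coverage (codeSet i) ⟨
    sum (λ w → coverage (codeSet i) (dec w))   ≡⟨ sum-cong-≗ (λ w → coverage-codeSet i (dec w)) ⟩
    sum {N} (λ _ → 1)                          ≡⟨ sum-const N 1 ⟩
    N * 1                                      ≡⟨ *-identityʳ N ⟩
    N                                          ∎
    where open ≡-Reasoning

module Rigidity (p-1 : ℕ) (5∣p : 5 ∣ suc p-1) where

  open Grid p-1 5∣p
  open Domination p-1 5∣p
  open Torus₅ using (Code; inCode; local-rigidity; code-translate; code-unique)
  private module T₅ = Torus 4

  Perfect : Subset N → V → Set
  Perfect S a = All (λ δ → coverage S (a ⊕ δ) ≡ 1) (ball 2)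

  Agrees : Subset N → Code → V → Set
  Agrees S i a = All (λ δ → member S (a ⊕ δ) ≡ inCode i (π (a ⊕ δ))) (ball 3)

  perfect⇒agrees : ∀ S a → Perfect S a → ∃[ i ] Agrees S i a
  perfect⇒agrees S a perfect =
    let i₀ , matches = local-rigidity (member S ∘ (a ⊕_)) (All.map (λ {δ} → local {δ}) perfect)
        j , translated = code-translate i₀ (π a)
    in j , All.zipWith (λ {δ} (m , t) → trans m (trans (sym t) (cong (inCode j) (sym (π-⊕ a δ)))))
                       (matches , translated)
    where
    local : ∀ {δ} → coverage S (a ⊕ δ) ≡ 1 → count (member S ∘ (a ⊕_)) (closedNbhdₒ δ) ≡ 1
    local {δ} c≡1 = begin
      count (member S ∘ (a ⊕_)) (closedNbhdₒ δ)       ≡⟨ count-map (member S) (a ⊕_) (closedNbhdₒ δ) ⟨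
      count (member S) (map (a ⊕_) (closedNbhdₒ δ))   ≡⟨ cong (count (member S)) (⊕-closedNbhd a δ) ⟩
      coverage S (a ⊕ δ)                              ≡⟨ c≡1 ⟩
      1                                               ∎
      where open ≡-Reasoning

  core⁻ : ∀ {δ} → δ ∈ core → δ ∈ ball 3 × mvₒ right δ ∈ ball 3 × mvₒ up δ ∈ ball 3
  core⁻ δ∈ = let δ∈ball , r∈ , u∈ = ∈-filter⁻ core? δ∈ in δ∈ball , r∈ , u∈

  SameAround : Subset N → Subset N → V → Set
  SameAround S E a = All (λ δ → member S (a ⊕ δ) ≡ member E (a ⊕ δ)) core

  agrees-unique : ∀ S E a {i j} → SameAround S E a → Agrees S i a → Agrees E j a → i ≡ j
  agrees-unique S E a {i} {j} same agS agE = code-unique (π a) i j (All.tabulate λ {δ} δ∈ →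
    let δ∈ball = proj₁ (core⁻ δ∈) in begin
      inCode i (π a T₅.⊕ δ)   ≡⟨ cong (inCode i) (π-⊕ a δ) ⟨
      inCode i (π (a ⊕ δ))    ≡⟨ All.lookup agS δ∈ball ⟨
      member S (a ⊕ δ)        ≡⟨ All.lookup same δ∈ ⟩
      member E (a ⊕ δ)        ≡⟨ All.lookup agE δ∈ball ⟩
      inCode j (π (a ⊕ δ))    ≡⟨ cong (inCode j) (π-⊕ a δ) ⟩
      inCode j (π a T₅.⊕ δ)   ∎)
    where open ≡-Reasoning

  agrees-mv : ∀ d → (∀ {δ} → δ ∈ core → mvₒ d δ ∈ ball 3) →
              ∀ S a {i j} → Agrees S i a → Agrees S j (mv d a) → i ≡ j
  agrees-mv d core-mv S a {i} {j} ag ag′ = code-unique (π (mv d a)) i j (All.tabulate λ {δ} δ∈ → begin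
      inCode i (π (mv d a) T₅.⊕ δ)   ≡⟨ cong (inCode i) (π-⊕ (mv d a) δ) ⟨
      inCode i (π (mv d a ⊕ δ))      ≡⟨ cong (inCode i ∘ π) (mv-⊕ a d δ) ⟩
      inCode i (π (a ⊕ mvₒ d δ))     ≡⟨ All.lookup ag (core-mv δ∈) ⟨
      member S (a ⊕ mvₒ d δ)         ≡⟨ cong (member S) (mv-⊕ a d δ) ⟨
      member S (mv d a ⊕ δ)          ≡⟨ All.lookup ag′ (proj₁ (core⁻ δ∈)) ⟩
      inCode j (π (mv d a ⊕ δ))      ≡⟨ cong (inCode j) (π-⊕ (mv d a) δ) ⟩
      inCode j (π (mv d a) T₅.⊕ δ)   ∎)
    where open ≡-Reasoning

  row-code : ∀ S y → (∀ x → Perfect S (x , y)) → ∃[ i ] ∀ x → Agrees S i (x , y)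
  row-code S y perfect =
    let i , ag₀ = perfect⇒agrees S (zero , y) (perfect zero)
    in i , csuc-induction (λ x → Agrees S i (x , y)) ag₀ λ x ag →
         let j , ag′ = perfect⇒agrees S (csuc x , y) (perfect (csuc x))
         in subst (λ k → Agrees S k (csuc x , y))
                  (sym (agrees-mv right (proj₁ ∘ proj₂ ∘ core⁻) S (x , y) {i} {j} ag ag′)) ag′

  column-code : ∀ S x → (∀ y → Perfect S (x , y)) → ∃[ i ] ∀ y → Agrees S i (x , y)
  column-code S x perfect =
    let i , ag₀ = perfect⇒agrees S (x , zero) (perfect zero)
    in i , csuc-induction (λ y → Agrees S i (x , y)) ag₀ λ y ag →
         let j , ag′ = perfect⇒agrees S (x , csuc y) (perfect (csuc y))
         in subst (λ k → Agrees S k (x , csuc y))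
                  (sym (agrees-mv up (proj₂ ∘ proj₂ ∘ core⁻) S (x , y) {i} {j} ag ag′)) ag′

  codeSet-agrees : ∀ i a → Agrees (codeSet i) i a
  codeSet-agrees i a = All.tabulate λ {δ} _ → member-codeSet i (a ⊕ δ)

module LowerBound (p-1 : ℕ) (5∣p : 5 ∣ suc p-1) (m : ℕ) (50m≤p : 50 * m ≤ suc p-1) where

  open Grid p-1 5∣p
  open Domination p-1 5∣p
  open Rigidity p-1 5∣p
  open Torus₅ using (Code)
  open Reconfiguration G using (kt-first)

  near : ℕ → C → List C
  near r y = map (λ k → shift k y) (window r)

  near-shift : ∀ r {d} → ℤ.- d ∈ window r → ∀ y → y ∈ near r (shift d y)
  near-shift r {d} -d∈ y = subst (_∈ near r (shift d y)) (shift-neg d y) (∈-map⁺ (λ k → shift k (shift d y)) -d∈)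

  length-near : ∀ r y → length (near r y) ≡ suc (r + r)
  length-near r y = trans (length-map _ (window r)) (trans (length-map _ (upTo (suc (r + r)))) (length-upTo (suc (r + r))))

  linesNear : (V → C) → ℕ → List (Fin N) → List C
  linesNear line r []       = []
  linesNear line r (w ∷ ws) = near r (line (dec w)) ++ linesNear line r ws

  length-linesNear : ∀ line r ws → length (linesNear line r ws) ≡ suc (r + r) * length ws
  length-linesNear line r []       = sym (*-zeroʳ (suc (r + r)))
  length-linesNear line r (w ∷ ws) = begin
    length (near r (line (dec w)) ++ linesNear line r ws)          ≡⟨ length-++ (near r (line (dec w))) ⟩
    length (near r (line (dec w))) + length (linesNear line r ws)  ≡⟨ cong₂ _+_ (length-near r _) (length-linesNear line r ws) ⟩
    suc (r + r) + suc (r + r) * length ws                          ≡⟨ *-suc (suc (r + r)) (length ws) ⟨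
    suc (r + r) * suc (length ws)                                  ∎
    where open ≡-Reasoning

  ∈-linesNear : ∀ line r {w ws y} → w ∈ ws → y ∈ near r (line (dec w)) → y ∈ linesNear line r ws
  ∈-linesNear line r {ws = w ∷ ws}  (here refl) y∈ = ∈-++⁺ˡ y∈
  ∈-linesNear line r {ws = w′ ∷ ws} (there w∈)  y∈ = ∈-++⁺ʳ (near r (line (dec w′))) (∈-linesNear line r w∈ y∈)

  opaque
    ball2-window : All (λ δ → ℤ.- proj₁ δ ∈ window 2 × ℤ.- proj₂ δ ∈ window 2) (ball 2)
    ball2-window =
      toWitness {a? = All.all? (λ δ → ℤ.- proj₁ δ ∈ℤ? window 2 ×-dec ℤ.- proj₂ δ ∈ℤ? window 2) (ball 2)} _

    ball3-window : All (λ δ → ℤ.- proj₂ δ ∈ window 3) (ball 3)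
    ball3-window = toWitness {a? = All.all? (λ δ → ℤ.- proj₂ δ ∈ℤ? window 3) (ball 3)} _

  Clear : Subset N → V → Set
  Clear S a = All (λ δ → enc (a ⊕ δ) ∉ overcovered S) (ball 2)

  blockedRows blockedColumns : Subset N → List C
  blockedRows    S = linesNear proj₂ 2 (overcovered S)
  blockedColumns S = linesNear proj₁ 2 (overcovered S)

  perfect-at : ∀ S a → (∀ b → 1 ≤ coverage S b) → Clear S a → Perfect S a
  perfect-at S a covered = All.map λ {δ} ∉over → exactly-one (covered (a ⊕ δ)) λ 2≤ →
    ∉over (∈-filter⁺ (λ w → 2 ≤? coverage S (dec w)) (∈-allFin _)
                     (subst (λ c → 2 ≤ coverage S c) (sym (dec-enc _)) 2≤))
    where
    exactly-one : ∀ {c} → 1 ≤ c → ¬ (2 ≤ c) → c ≡ 1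
    exactly-one {suc zero}    _ _   = refl
    exactly-one {suc (suc c)} _ ¬2≤ = contradiction (s≤s (s≤s z≤n)) ¬2≤

  row-clear : ∀ S y → y ∉ blockedRows S → ∀ x → Clear S (x , y)
  row-clear S y y∉ x = All.map (λ {δ} (_ , -dy∈) over → y∉ (∈-linesNear proj₂ 2 over
    (subst (λ c → y ∈ near 2 (proj₂ c)) (sym (dec-enc ((x , y) ⊕ δ))) (near-shift 2 -dy∈ y)))) ball2-window

  column-clear : ∀ S x → x ∉ blockedColumns S → ∀ y → Clear S (x , y)
  column-clear S x x∉ y = All.map (λ {δ} (-dx∈ , _) over → x∉ (∈-linesNear proj₁ 2 over
    (subst (λ c → x ∈ near 2 (proj₁ c)) (sym (dec-enc ((x , y) ⊕ δ))) (near-shift 2 -dx∈ x)))) ball2-window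

  unchanged-near : ∀ S E {z} → (∀ w → w ≢ z → lookup S w ≡ lookup E w) →
                   ∀ y → y ∉ near 3 (proj₂ (dec z)) → ∀ x → SameAround S E (x , y)
  unchanged-near S E {z} same y y∉ x = filter⁺ core? (All.map (λ {δ} -dy∈ → same _ λ eq →
    y∉ (subst (λ c → y ∈ near 3 (proj₂ c)) (trans (sym (dec-enc _)) (cong dec eq)) (near-shift 3 -dy∈ y))) ball3-window)

  code₀ code₁ : Code
  code₀ = zero , zero
  code₁ = suc zero , zero

  RowsFollow₀ : Subset N → Set
  RowsFollow₀ S = ∀ y i → (∀ x → Agrees S i (x , y)) → i ≡ code₀

  few-overcovered : ∀ S {k} → Dominating G S → ∣ S ∣ ≤ k → 5 * k < N + 5 * m →
                    length (overcovered S) < 5 * m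
  few-overcovered S {k} dom S≤k bound = +-cancelˡ-< N (length (overcovered S)) (5 * m)
    (≤-<-trans (overcovered-bound dom) (≤-<-trans (*-monoʳ-≤ 5 S≤k) bound))

  25m+25m≡50m : 5 * (5 * m) + 5 * (5 * m) ≡ 50 * m
  25m+25m≡50m = arith m
    where
    arith : ∀ t → 5 * (5 * t) + 5 * (5 * t) ≡ 50 * t
    arith = solve-∀

  short-rows : ∀ {a b} → a < 5 * m → b < 5 * m → 5 * a + (5 * b + 7) < p
  short-rows {a} {b} a< b< = begin-strict
    5 * a + (5 * b + 7)           <⟨ m<m+n _ {3} (s≤s z≤n) ⟩
    5 * a + (5 * b + 7) + 3       ≡⟨ arith a b ⟩
    5 * suc a + 5 * suc b         ≤⟨ +-mono-≤ (*-monoʳ-≤ 5 a<) (*-monoʳ-≤ 5 b<) ⟩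
    5 * (5 * m) + 5 * (5 * m)     ≡⟨ 25m+25m≡50m ⟩
    50 * m                        ≤⟨ 50m≤p ⟩
    p                             ∎
    where
    open ≤-Reasoning
    arith : ∀ a b → 5 * a + (5 * b + 7) + 3 ≡ 5 * suc a + 5 * suc b
    arith = solve-∀

  short-columns : ∀ {b} → b < 5 * m → 5 * b < p
  short-columns b< = <-≤-trans (*-monoʳ-< 5 b<) (≤-trans (m≤m+n _ _) (≤-trans (≤-reflexive 25m+25m≡50m) 50m≤p))

  single-difference : ∀ {S E : Subset N} → AdjacentSets S E →
                      ∃[ z ] ∀ w → w ≢ z → lookup S w ≡ lookup E w
  single-difference {S} {E} adj = hamming-one S E (trans (sym (∣─∣+∣─∣≡hamming S E)) adj)

  -- The rows near overcovered vertices of S or E (5 per vertex) or near the changed vertex z (7).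
  free-row : ∀ S E z → length (overcovered S) < 5 * m → length (overcovered E) < 5 * m →
             ∃[ y ] (y ∉ blockedRows S × y ∉ blockedRows E × y ∉ near 3 (proj₂ (dec z)))
  free-row S E z fewS fewE =
    let y , y∉ = missing (rowsS ++ rowsE ++ near3) (subst (_< p) (sym blocked-length) (short-rows fewS fewE))
    in y , (y∉ ∘ ∈-++⁺ˡ) , (y∉ ∘ ∈-++⁺ʳ rowsS ∘ ∈-++⁺ˡ) , (y∉ ∘ ∈-++⁺ʳ rowsS ∘ ∈-++⁺ʳ rowsE)
    where
    rowsS = blockedRows S
    rowsE = blockedRows E
    near3 = near 3 (proj₂ (dec z))
    blocked-length : length (rowsS ++ rowsE ++ near3) ≡ 5 * length (overcovered S) + (5 * length (overcovered E) + 7)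
    blocked-length = trans (length-++ rowsS) (cong₂ _+_ (length-linesNear proj₂ 2 (overcovered S))
      (trans (length-++ rowsE) (cong₂ _+_ (length-linesNear proj₂ 2 (overcovered E)) (length-near 3 (proj₂ (dec z))))))

  free-column : ∀ E → length (overcovered E) < 5 * m → ∃[ x ] x ∉ blockedColumns E
  free-column E fewE =
    missing (blockedColumns E) (subst (_< p) (sym (length-linesNear proj₁ 2 (overcovered E))) (short-columns fewE))

  row-code-if-clear : ∀ S → Dominating G S → ∀ y → y ∉ blockedRows S → ∃[ i ] ∀ x → Agrees S i (x , y)
  row-code-if-clear S dom y y∉ =
    row-code S y λ x → perfect-at S (x , y) (dominating⇒covered S dom) (row-clear S y y∉ x)

  column-code-if-clear : ∀ S → Dominating G S → ∀ x → x ∉ blockedColumns S → ∃[ i ] ∀ y → Agrees S i (x , y)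
  column-code-if-clear S dom x x∉ =
    column-code S x λ y → perfect-at S (x , y) (dominating⇒covered S dom) (column-clear S x x∉ y)

  rows-follow-step : ∀ {k S E} → 5 * k < N + 5 * m →
                     Dominating G S → ∣ S ∣ ≤ k → Dominating G E → ∣ E ∣ ≤ k → AdjacentSets S E →
                     RowsFollow₀ S → RowsFollow₀ E
  rows-follow-step {k} {S} {E} bound domS S≤k domE E≤k adj followS y i rowE-i =
    let z , same                = single-difference {S} {E} adj
        fewE                    = few-overcovered E domE E≤k bound
        y₀ , y₀∉S , y₀∉E , y₀∉z = free-row S E z (few-overcovered S domS S≤k bound) fewE
        x₀ , x₀∉                = free-column E fewE
        iS , rowS               = row-code-if-clear S domS y₀ y₀∉S
        iE , rowE               = row-code-if-clear E domE y₀ y₀∉E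
        iC , colE               = column-code-if-clear E domE x₀ x₀∉
    in begin
      i     ≡⟨ agrees-unique E E (x₀ , y) (All.tabulate λ _ → refl) (rowE-i x₀) (colE y) ⟩
      iC    ≡⟨ agrees-unique E E (x₀ , y₀) (All.tabulate λ _ → refl) (colE y₀) (rowE x₀) ⟩
      iE    ≡⟨ agrees-unique S E (zero , y₀) (unchanged-near S E same y₀ y₀∉z zero) (rowS zero) (rowE zero) ⟨
      iS    ≡⟨ followS y₀ iS rowS ⟩
      code₀ ∎
    where open ≡-Reasoning

  rows-follow-codeSet₀ : RowsFollow₀ (codeSet code₀)
  rows-follow-codeSet₀ y i row = agrees-unique (codeSet code₀) (codeSet code₀) (zero , y) (All.tabulate λ _ → refl)
                                                (row zero) (codeSet-agrees code₀ (zero , y))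

  lower-bound : ∀ k → KTransforms G k (codeSet code₀) (codeSet code₁) → N + 5 * m ≤ 5 * k
  lower-bound k path = ≮⇒≥ λ bound →
    code₁≢code₀ (follow bound path rows-follow-codeSet₀ zero code₁ λ x → codeSet-agrees code₁ (x , zero))
    where
    code₁≢code₀ : code₁ ≢ code₀
    code₁≢code₀ ()
    follow : 5 * k < N + 5 * m → ∀ {S} → KTransforms G k S (codeSet code₁) →
             RowsFollow₀ S → RowsFollow₀ (codeSet code₁)
    follow bound (done _ _)             rows = rows
    follow bound (step domS S≤k adj P) rows =
      follow bound P (rows-follow-step bound domS S≤k (proj₁ (kt-first P)) (proj₂ (kt-first P)) adj rows)

module Witness (t : ℕ) where

  m : ℕ
  m = suc t

  -- suc p-1 reduces to 50 * m, as 50 * m is a successor.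
  p-1 : ℕ
  p-1 = pred (50 * m)

  5∣p : 5 ∣ suc p-1
  5∣p = divides (10 * m) (trans (*-assoc 5 10 m) (*-comm 5 (10 * m)))

  open Grid p-1 5∣p public using (N; G; regular)
  open Embedding p-1 5∣p public using (embeds)
  open Domination p-1 5∣p public using (codeSet; codeSet-dominating; codeSet-size)
  open LowerBound p-1 5∣p m ≤-refl public using (code₀; code₁; lower-bound)

  D₀ D₁ : Subset N
  D₀ = codeSet code₀
  D₁ = codeSet code₁

  distance : ∃[ d ] ReconfDist G D₀ D₁ d
  distance = Reconfiguration.reconfDist-exists G (codeSet-dominating code₀) (codeSet-dominating code₁)

  d : ℕ
  d = proj₁ distance

  5*max≡N : 5 * (∣ D₀ ∣ ⊔ ∣ D₁ ∣) ≡ N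
  5*max≡N = begin
    5 * (∣ D₀ ∣ ⊔ ∣ D₁ ∣)   ≡⟨ cong (λ s → 5 * (∣ D₀ ∣ ⊔ s)) (sym same-size) ⟩
    5 * (∣ D₀ ∣ ⊔ ∣ D₀ ∣)   ≡⟨ cong (5 *_) (⊔-idem ∣ D₀ ∣) ⟩
    5 * ∣ D₀ ∣              ≡⟨ *-comm 5 ∣ D₀ ∣ ⟩
    ∣ D₀ ∣ * 5              ≡⟨ codeSet-size code₀ ⟩
    N                       ∎
    where
    open ≡-Reasoning
    same-size : ∣ D₀ ∣ ≡ ∣ D₁ ∣
    same-size = *-cancelʳ-≡ ∣ D₀ ∣ ∣ D₁ ∣ 5 (trans (codeSet-size code₀) (sym (codeSet-size code₁)))

  m≤d : m ≤ d
  m≤d = *-cancelˡ-≤ 5 (+-cancelˡ-≤ N (5 * m) (5 * d) (begin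
    N + 5 * m                          ≤⟨ lower-bound _ (proj₁ (proj₂ (proj₂ distance))) ⟩
    5 * (d + (∣ D₀ ∣ ⊔ ∣ D₁ ∣))        ≡⟨ *-distribˡ-+ 5 d _ ⟩
    5 * d + 5 * (∣ D₀ ∣ ⊔ ∣ D₁ ∣)      ≡⟨ cong (5 * d +_) 5*max≡N ⟩
    5 * d + N                          ≡⟨ +-comm (5 * d) N ⟩
    N + 5 * d                          ∎))
    where open ≤-Reasoning

  N≤2500d² : N ≤ 2500 * (d * d)
  N≤2500d² = begin
    N                    ≡⟨ square m ⟩
    2500 * (m * m)       ≤⟨ *-monoʳ-≤ 2500 (*-mono-≤ m≤d m≤d) ⟩
    2500 * (d * d)       ∎
    where
    open ≤-Reasoning
    square : ∀ t → 50 * t * (50 * t) ≡ 2500 * (t * t)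
    square = solve-∀

  m≤N : m ≤ N
  m≤N = ≤-trans (m≤n*m m 50) (m≤m*n (50 * m) (50 * m))

theorem1 : ∃[ m ] ∀ (n : ℕ) → 1 ≤ n →
    ∃[ N ] Σ (Graph N) λ G →
      n ≤ N × Regular 4 G × EmbedsOnTorus G
      × ∃[ D ] ∃[ D' ] (Dominating G D × Dominating G D'
        × ∣ D ∣ * 5 ≡ N × ∣ D' ∣ * 5 ≡ N
        × ∃[ d ] (ReconfDist G D D' d × N ≤ suc m * (d * d)))
theorem1 = 2499 , λ where
  (suc t) _ → let open Witness t in
    N , G , m≤N , regular , embeds , D₀ , D₁ , codeSet-dominating code₀ , codeSet-dominating code₁ ,
    codeSet-size code₀ , codeSet-size code₁ , d , proj₂ distance , N≤2500d²
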